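{- Let $\mathbb{K}$ be a field, and let $d\ge 2$ and $r_d,\ldots,r_1$ be positive integers such that $r_i^2\ge r_{i-1}$ for all $1<i\le d$. If $\psi_d(\mathbb{K})<\infty$, then $$V_d(r_d,\ldots,r_1;\mathbb{K})\le 2\,r_d^{2^{d-1}}\bigl(\psi_d(\mathbb{K})+1\bigr)^{2^{d-1}-1}.$$
   Context: For non-negative integers $r_d,\ldots,r_1$, let $\mathcal{G}_d(r_d,\ldots,r_1)$ be the set of tuples of $r_d+\cdots+r_1$ homogeneous polynomials with coefficients in $\mathbb{K}$, of which $r_i$ have degree $i$ for each $1\le i\le d$, which possess no common non-trivial zero with coordinates in $\mathbb{K}$. Define $V_d(r_d,\ldots,r_1;\mathbb{K})=\sup_{\mathbf{h}\in\mathcal{G}_d(r_d,\ldots,r_1)}\nu(\mathbf{h})$, where $\nu(\mathbf{h})$ is the number of variables appearing explicitly in $\mathbf{h}$. For $d\ge1$ let $\phi_d(\mathbb{K})$ be the supremum of $\nu(f)$ over all diagonal forms $f=a_0x_0^d+\cdots+a_sx_s^d$ with coefficients in $\mathbb{K}$ possessing no non-trivial zero over $\mathbb{K}$, and set $\psi_d(\mathbb{K})=\sup_{1\le i\le d}\phi_i(\mathbb{K})$. -}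

module Defs where

open import Level using (Level; _⊔_)
open import Algebra.Bundles using (CommutativeRing)
open import Data.Nat as ℕ using (ℕ; zero; suc; _≤_; _∸_)
open import Data.Fin using (Fin)
import Data.Fin
open import Data.Vec using (Vec; []; _∷_; lookup)
open import Data.List using (List; []; _∷_; [_]; map; concatMap; upTo; foldr)
open import Data.List.Membership.Propositional using (_∈_)
open import Data.Product using (Σ; ∃; _×_; _,_)
open import Relation.Nullary using (¬_)
open import Function.Definitions using (Injective)
open import Relation.Binary.PropositionalEquality using (_≡_)

record Field (c ℓ : Level) : Set (Level.suc (c ⊔ ℓ)) where
  field
    commutativeRing : CommutativeRing c ℓ
  open CommutativeRing commutativeRing public
  field
    0≉1     : ¬ (0# ≈ 1#)
    inverse : ∀ x → ¬ (x ≈ 0#) → Σ Carrier (λ y → (x * y) ≈ 1#)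

-- All exponent vectors (monomials) of total degree i in n variables.
monomials : (n i : ℕ) → List (Vec ℕ n)
monomials zero    zero    = [ [] ]
monomials zero    (suc i) = []
monomials (suc n) i       = concatMap (λ k → map (k ∷_) (monomials n (i ∸ k))) (upTo (suc i))

module _ {c ℓ : Level} (K : Field c ℓ) where
  open Field K

  pow : Carrier → ℕ → Carrier
  pow x zero    = 1#
  pow x (suc k) = x * pow x k

  monoVal : ∀ {n} → Vec ℕ n → (Fin n → Carrier) → Carrier
  monoVal []      x = 1#
  monoVal (k ∷ e) x = pow (x Data.Fin.zero) k * monoVal e (λ j → x (Data.Fin.suc j))

  -- A homogeneous form of degree i in n variables over K, given by its
  -- coefficient on each monomial (only monomials of degree i are used).
  Form : ℕ → ℕ → Set c
  Form n i = Vec ℕ n → Carrier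

  sumL : List Carrier → Carrier
  sumL = foldr _+_ 0#

  eval : ∀ {n i} → Form n i → (Fin n → Carrier) → Carrier
  eval {n} {i} f x = sumL (map (λ e → f e * monoVal e x) (monomials n i))

  Appears : ∀ {n i} → Form n i → Fin n → Set ℓ
  Appears {n} {i} f j = ∃ λ e → e ∈ monomials n i × (1 ≤ lookup e j) × ¬ (f e ≈ 0#)

  NonTrivial : ∀ {n} → (Fin n → Carrier) → Set ℓ
  NonTrivial x = ∃ λ j → ¬ (x j ≈ 0#)

  -- "at most B variables satisfy P": every injective family of variables
  -- satisfying P has size ≤ B.
  AtMost : ∀ {n} {p} → (Fin n → Set p) → ℕ → Set p
  AtMost {n} P B = ∀ k (ι : Fin k → Fin n) → Injective _≡_ _≡_ ι → (∀ t → P (ι t)) → k ≤ B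

  System : (d : ℕ) → (ℕ → ℕ) → ℕ → Set c
  System d r n = (i : ℕ) → 1 ≤ i → i ≤ d → Fin (r i) → Form n i

  AppearsIn : ∀ {d r n} → System d r n → Fin n → Set ℓ
  AppearsIn {d} {r} {n} h j = ∃ λ i → Σ (1 ≤ i) λ p → Σ (i ≤ d) λ q → ∃ λ (l : Fin (r i)) → Appears {n} {i} (h i p q l) j

  νSys≤ : ∀ {d r n} → System d r n → ℕ → Set ℓ
  νSys≤ {d} {r} h B = AtMost (AppearsIn {d} {r} h) B

  NoCommonZero : ∀ {d r n} → System d r n → Set (c ⊔ ℓ)
  NoCommonZero {d} {r} {n} h =
    ¬ (Σ (Fin n → Carrier) λ x → NonTrivial x ×
        (∀ i (p : 1 ≤ i) (q : i ≤ d) (l : Fin (r i)) → eval {n} {i} (h i p q l) x ≈ 0#))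

  V≤ : (d : ℕ) → (ℕ → ℕ) → ℕ → Set (c ⊔ ℓ)
  V≤ d r B = ∀ n (h : System d r n) → NoCommonZero {d} {r} h → νSys≤ {d} {r} h B

  diagEval : ∀ {m} → ℕ → (Fin m → Carrier) → (Fin m → Carrier) → Carrier
  diagEval {zero}  i a x = 0#
  diagEval {suc m} i a x = a Data.Fin.zero * pow (x Data.Fin.zero) i
                           + diagEval i (λ t → a (Data.Fin.suc t)) (λ t → x (Data.Fin.suc t))

  DiagNoZero : ∀ {m} → ℕ → (Fin m → Carrier) → Set (c ⊔ ℓ)
  DiagNoZero {m} i a = ¬ (Σ (Fin m → Carrier) λ x → NonTrivial x × (diagEval i a x ≈ 0#))

  -- ν of a diagonal form is ≤ B (x_t appears iff a_t ≠ 0)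
  νDiag≤ : ∀ {m} → (Fin m → Carrier) → ℕ → Set ℓ
  νDiag≤ a B = AtMost (λ t → ¬ (a t ≈ 0#)) B

  φ≤ : ℕ → ℕ → Set (c ⊔ ℓ)
  φ≤ i M = ∀ m (a : Fin m → Carrier) → DiagNoZero i a → νDiag≤ a M

  ψ≤ : ℕ → ℕ → Set (c ⊔ ℓ)
  ψ≤ d M = ∀ i → 1 ≤ i → i ≤ d → φ≤ i M

module Submission where

-- Induction on the top degree, eliminating top-degree forms one at a time. Given a
-- top form F and a common root y of the other top forms and the lower forms (which
-- exists by induction on their number), restrict everything to the points t y + z,
-- z in a hyperplane x_c = 0 missing y. Expanded in t, the other top forms keep only
-- their z-part, F becomes F(0, z) + F(y) t^D, and every intermediate coefficient
-- is a new form of lower degree. Repeating this diagonalBound + 1 times turns F into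
-- F′(z) + ∑ aⱼ tⱼ^D, a form which has a nontrivial root because diagonal forms in
-- that many variables are isotropic. Counting the variables spent and the lower
-- forms created gives the recursion variableBound, whose closed form is the bound.

open import Defs
open import Level using (Level; _⊔_)
open import Data.Nat using (ℕ)

module Arithmetic where
  open import Data.Nat
  open import Data.Nat.Properties
  open import Relation.Binary.PropositionalEquality
  open import Data.Nat.Tactic.RingSolver using (solve-∀)
  open import Function using (_∘_)
  open import Relation.Nullary using (contradiction)
  open ≤-Reasoning

  ^-distribʳ-* : ∀ m n o → (m * n) ^ o ≡ m ^ o * n ^ o
  ^-distribʳ-* m n zero    = refl
  ^-distribʳ-* m n (suc o) =
    trans (cong (m * n *_) (^-distribʳ-* m n o)) ([m*n]*[o*p]≡[m*o]*[n*p] m n (m ^ o) (n ^ o))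

  m^[2*n]≡m^n*m^n : ∀ m n → m ^ (2 * n) ≡ m ^ n * m ^ n
  m^[2*n]≡m^n*m^n m n = trans (cong (λ k → m ^ (n + k)) (+-identityʳ n)) (^-distribˡ-+-* m n n)

  m^2^[1+n]≡[m*m]^2^n : ∀ m n → m ^ (2 ^ suc n) ≡ (m * m) ^ (2 ^ n)
  m^2^[1+n]≡[m*m]^2^n m n = trans (m^[2*n]≡m^n*m^n m (2 ^ n)) (sym (^-distribʳ-* m m (2 ^ n)))

  m≤m^n : ∀ m {n} → 1 ≤ n → m ≤ m ^ n
  m≤m^n zero    _       = z≤n
  m≤m^n (suc m) {suc n} _ = m≤m*n (suc m) (suc m ^ n) {{m^n≢0 (suc m) n}}

  squaringSum : ℕ → ℕ → ℕ
  squaringSum zero    m = m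
  squaringSum (suc k) m = m ^ (2 ^ suc k) + squaringSum k m

  m^2^k≤squaringSum : ∀ k m → m ^ (2 ^ k) ≤ squaringSum k m
  m^2^k≤squaringSum zero    m = ≤-reflexive (*-identityʳ m)
  m^2^k≤squaringSum (suc k) m = m≤m+n _ _

  squaringSum+n≤[m+n]^2^k : ∀ k m n → 1 ≤ n → squaringSum k m + n ≤ (m + n) ^ (2 ^ k)
  squaringSum+n≤[m+n]^2^k zero    m n _   = ≤-reflexive (sym (*-identityʳ (m + n)))
  squaringSum+n≤[m+n]^2^k (suc k) m n 1≤n = begin
    squaringSum (suc k) m + n    ≡⟨ cong (λ z → z + squaringSum k m + n) (m^[2*n]≡m^n*m^n m (2 ^ k)) ⟩
    b * b + squaringSum k m + n  ≡⟨ +-assoc (b * b) (squaringSum k m) n ⟩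
    b * b + (squaringSum k m + n) ≤⟨ +-mono-≤ (*-monoˡ-≤ b b≤a) ih ⟩
    a * b + a                    ≡⟨ +-comm (a * b) a ⟩
    a + a * b                    ≡⟨ sym (*-suc a b) ⟩
    a * suc b                    ≤⟨ *-monoʳ-≤ a b<a ⟩
    a * a                        ≡⟨ sym (m^[2*n]≡m^n*m^n (m + n) (2 ^ k)) ⟩
    (m + n) ^ (2 ^ suc k)        ∎
    where
      a = (m + n) ^ (2 ^ k)
      b = m ^ (2 ^ k)
      ih : squaringSum k m + n ≤ a
      ih = squaringSum+n≤[m+n]^2^k k m n 1≤n
      b≤a : b ≤ a
      b≤a = ^-monoˡ-≤ (2 ^ k) (m≤m+n m n)
      b<a : b < a
      b<a = ≤-trans (≤-reflexive (+-comm 1 b)) (≤-trans (+-monoʳ-≤ b 1≤n) (≤-trans (+-monoˡ-≤ n (m^2^k≤squaringSum k m)) ih))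

  𝟙[_≡_] : ℕ → ℕ → ℕ
  𝟙[ zero  ≡ zero  ] = 1
  𝟙[ zero  ≡ suc _ ] = 0
  𝟙[ suc _ ≡ zero  ] = 0
  𝟙[ suc i ≡ suc j ] = 𝟙[ i ≡ j ]

  𝟙[_≤_] : ℕ → ℕ → ℕ
  𝟙[ zero  ≤ _     ] = 1
  𝟙[ suc _ ≤ zero  ] = 0
  𝟙[ suc j ≤ suc i ] = 𝟙[ j ≤ i ]

  𝟙[i≡i] : ∀ i → 𝟙[ i ≡ i ] ≡ 1
  𝟙[i≡i] zero    = refl
  𝟙[i≡i] (suc i) = 𝟙[i≡i] i

  𝟙[i≡j]≡0 : ∀ {i j} → i ≢ j → 𝟙[ i ≡ j ] ≡ 0
  𝟙[i≡j]≡0 {zero}  {zero}  i≢j = contradiction refl i≢j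
  𝟙[i≡j]≡0 {zero}  {suc j} i≢j = refl
  𝟙[i≡j]≡0 {suc i} {zero}  i≢j = refl
  𝟙[i≡j]≡0 {suc i} {suc j} i≢j = 𝟙[i≡j]≡0 (i≢j ∘ cong suc)

  𝟙[j≤i]-split : ∀ j i → 𝟙[ j ≤ i ] ≡ 𝟙[ i ≡ j ] + 𝟙[ suc j ≤ i ]
  𝟙[j≤i]-split zero    zero    = refl
  𝟙[j≤i]-split zero    (suc i) = refl
  𝟙[j≤i]-split (suc j) zero    = refl
  𝟙[j≤i]-split (suc j) (suc i) = 𝟙[j≤i]-split j i

  𝟙[j≤i]≤1 : ∀ j i → 𝟙[ j ≤ i ] ≤ 1
  𝟙[j≤i]≤1 zero    i       = ≤-refl
  𝟙[j≤i]≤1 (suc j) zero    = z≤n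
  𝟙[j≤i]≤1 (suc j) (suc i) = 𝟙[j≤i]≤1 j i

  𝟙[j≤i]≡0 : ∀ {j i} → i < j → 𝟙[ j ≤ i ] ≡ 0
  𝟙[j≤i]≡0 {suc j} {zero}  _         = refl
  𝟙[j≤i]≡0 {suc j} {suc i} (s≤s i<j) = 𝟙[j≤i]≡0 i<j

  squaring-chain : ∀ d (r : ℕ → ℕ) → (∀ i → 2 ≤ i → i ≤ d → r (i ∸ 1) ≤ r i ^ 2) →
                   ∀ m → m < d → r (d ∸ m) ≤ r d ^ (2 ^ m)
  squaring-chain d r r≤r² zero    _   = ≤-reflexive (sym (*-identityʳ (r d)))
  squaring-chain d r r≤r² (suc m) m<d = begin
    r (d ∸ suc m)        ≡⟨ cong r (sym (trans (∸-+-assoc d m 1) (cong (d ∸_) (+-comm m 1)))) ⟩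
    r (d ∸ m ∸ 1)        ≤⟨ r≤r² (d ∸ m) 2≤d∸m (m∸n≤m d m) ⟩
    r (d ∸ m) ^ 2        ≤⟨ ^-monoˡ-≤ 2 (squaring-chain d r r≤r² m (<-trans (n<1+n m) m<d)) ⟩
    (r d ^ (2 ^ m)) ^ 2  ≡⟨ ^-*-assoc (r d) (2 ^ m) 2 ⟩
    r d ^ (2 ^ m * 2)    ≡⟨ cong (r d ^_) (*-comm (2 ^ m) 2) ⟩
    r d ^ (2 ^ suc m)    ∎
    where
      2≤d∸m : 2 ≤ d ∸ m
      2≤d∸m = subst (2 ≤_) (sym (+-∸-assoc 1 (<⇒≤ m<d))) (s≤s (m<n⇒0<n∸m m<d))

  module Bounds (M : ℕ) where

    -- Diagonal forms of degree D in more than diagonalBound D variables are isotropic: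
    -- in degree 1 already two variables suffice, in higher degree this is ψ_d ≤ M.
    diagonalBound : ℕ → ℕ
    diagonalBound zero          = 0
    diagonalBound (suc zero)    = 1
    diagonalBound (suc (suc _)) = M

    diagonalBound≤M : 1 ≤ M → ∀ D → diagonalBound D ≤ M
    diagonalBound≤M _   zero          = z≤n
    diagonalBound≤M 1≤M (suc zero)    = 1≤M
    diagonalBound≤M _   (suc (suc _)) = ≤-refl

    -- ρ bounds the number of top-degree forms; eliminating them one by one costs
    -- ρ · diagonalBound variables and leaves at most ρ² + M ρ² forms of the next degree.
    variableBound : ℕ → ℕ → ℕ
    variableBound zero    ρ = 0
    variableBound (suc D) ρ = variableBound D (ρ * ρ + M * (ρ * ρ)) + ρ * diagonalBound (suc D)

    variableBound-mono : ∀ D {ρ ρ′} → ρ ≤ ρ′ → variableBound D ρ ≤ variableBound D ρ′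
    variableBound-mono zero    _    = z≤n
    variableBound-mono (suc D) ρ≤ρ′ =
      +-mono-≤ (variableBound-mono D (+-mono-≤ ρ²≤ρ′² (*-monoʳ-≤ M ρ²≤ρ′²))) (*-monoˡ-≤ _ ρ≤ρ′)
      where ρ²≤ρ′² = *-mono-≤ ρ≤ρ′ ρ≤ρ′

    g+k[1+x]+Mx²≤g+M[1+x]² : ∀ g k x → k ≤ M → g + k * suc x + M * (x * x) ≤ g + M * (suc x * suc x)
    g+k[1+x]+Mx²≤g+M[1+x]² g k x k≤M = begin
      g + k * suc x + M * (x * x)          ≤⟨ +-monoˡ-≤ _ (+-monoʳ-≤ g (*-monoˡ-≤ (suc x) k≤M)) ⟩
      g + M * suc x + M * (x * x)          ≤⟨ m≤m+n _ (M * x) ⟩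
      g + M * suc x + M * (x * x) + M * x  ≡⟨ square-expansion g M x ⟩
      g + M * (suc x * suc x)              ∎
      where
        square-expansion : ∀ g M x → g + M * suc x + M * (x * x) + M * x ≡ g + M * (suc x * suc x)
        square-expansion = solve-∀

    -- One diagonalisation step trades a variable for a coefficient of the
    -- diagonal form and for suc x new lower-degree forms.
    variableBound-diagonalStep :
      ∀ D x g g′ k N → k ≤ diagonalBound (suc D) → diagonalBound (suc D) ≤ M → g′ ≤ g + k * suc x →
      variableBound D (g + M * (suc x * suc x)) + suc x * diagonalBound (suc D) < N + k →
      variableBound D (g′ + M * (x * x)) + x * diagonalBound (suc D) < N
    variableBound-diagonalStep D x g g′ k N k≤m m≤M g′≤ bound = +-cancelʳ-< k _ N (begin-strict
      variableBound D (g′ + M * (x * x)) + x * m + k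
        ≤⟨ +-mono-≤ (+-monoˡ-≤ (x * m) (variableBound-mono D g″≤)) k≤m ⟩
      variableBound D (g + M * (suc x * suc x)) + x * m + m
        ≡⟨ +-assoc (variableBound D _) (x * m) m ⟩
      variableBound D (g + M * (suc x * suc x)) + (x * m + m)
        ≡⟨ cong (variableBound D (g + M * (suc x * suc x)) +_) (+-comm (x * m) m) ⟩
      variableBound D (g + M * (suc x * suc x)) + suc x * m
        <⟨ bound ⟩
      N + k ∎)
      where
        m = diagonalBound (suc D)
        g″≤ : g′ + M * (x * x) ≤ g + M * (suc x * suc x)
        g″≤ = ≤-trans (+-monoˡ-≤ _ g′≤) (g+k[1+x]+Mx²≤g+M[1+x]² g k x (≤-trans k≤m m≤M))

    variableBound+ρ^2^D≤ : 1 ≤ M → ∀ D ρ →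
      variableBound (suc D) ρ + ρ ^ (2 ^ D) ≤ 2 * ρ ^ (2 ^ D) * (M + 1) ^ (2 ^ D ∸ 1)
    variableBound+ρ^2^D≤ _   zero    ρ = ≤-reflexive (base ρ)
      where
        base : ∀ ρ → ρ * 1 + ρ * 1 ≡ 2 * (ρ * 1) * 1
        base = solve-∀
    variableBound+ρ^2^D≤ 1≤M (suc D) ρ = begin
      variableBound (suc D) σ + ρ * M + X  ≡⟨ +-assoc (variableBound (suc D) σ) (ρ * M) X ⟩
      variableBound (suc D) σ + (ρ * M + X) ≤⟨ +-monoʳ-≤ (variableBound (suc D) σ) ρM+X≤XY ⟩
      variableBound (suc D) σ + X * Y      ≡⟨ cong (variableBound (suc D) σ +_) (sym σ^e≡XY) ⟩
      variableBound (suc D) σ + σ ^ e      ≤⟨ variableBound+ρ^2^D≤ 1≤M D σ ⟩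
      2 * σ ^ e * Z                        ≡⟨ cong (λ w → 2 * w * Z) σ^e≡XY ⟩
      2 * (X * Y) * Z                      ≡⟨ reassoc X Y Z ⟩
      2 * X * (Y * Z)                      ≡⟨ cong (2 * X *_) (sym (^-distribˡ-+-* (M + 1) e (e ∸ 1))) ⟩
      2 * X * (M + 1) ^ (e + (e ∸ 1))      ≡⟨ cong (λ w → 2 * X * (M + 1) ^ w) (sym exponent) ⟩
      2 * X * (M + 1) ^ (2 ^ suc D ∸ 1)    ∎
      where
        e = 2 ^ D
        σ = ρ * ρ + M * (ρ * ρ)
        X = ρ ^ (2 ^ suc D)
        Y = (M + 1) ^ e
        Z = (M + 1) ^ (e ∸ 1)
        reassoc : ∀ X Y Z → 2 * (X * Y) * Z ≡ 2 * X * (Y * Z)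
        reassoc = solve-∀
        factor : ∀ ρ M → ρ * ρ + M * (ρ * ρ) ≡ (ρ * ρ) * (M + 1)
        factor = solve-∀
        σ^e≡XY : σ ^ e ≡ X * Y
        σ^e≡XY = trans (cong (_^ e) (factor ρ M))
                   (trans (^-distribʳ-* (ρ * ρ) (M + 1) e) (cong (_* Y) (sym (m^2^[1+n]≡[m*m]^2^n ρ D))))
        exponent : 2 ^ suc D ∸ 1 ≡ e + (e ∸ 1)
        exponent = trans (cong (λ k → (e + k) ∸ 1) (+-identityʳ e)) (+-∸-assoc e (m^n>0 2 D))
        distrib : ∀ X M → X * M + X ≡ X * (M + 1)
        distrib = solve-∀
        ρM+X≤XY : ρ * M + X ≤ X * Y
        ρM+X≤XY = begin
          ρ * M + X    ≤⟨ +-monoˡ-≤ X (*-monoˡ-≤ M (m≤m^n ρ (m^n>0 2 (suc D)))) ⟩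
          X * M + X    ≡⟨ distrib X M ⟩
          X * (M + 1)  ≤⟨ *-monoʳ-≤ X (m≤m^n (M + 1) (m^n>0 2 D)) ⟩
          X * Y        ∎

module Horner {c ℓ : Level} (K : Field c ℓ) where
  open import Data.Nat using (ℕ; zero; suc)
  open import Data.Fin using (Fin) renaming (zero to fzero; suc to fsuc)
  import Data.Fin as Fin
  open import Data.Vec.Functional using (Vector; head; tail) renaming (_∷_ to _◂_)
  open import Data.Fin.Properties using (punchInᵢ≢i; punchOut-cong; punchOut-punchIn)
  open import Data.List using (List; []; _∷_)
  open import Data.List.Relation.Unary.All using (All; []; _∷_)
  open import Data.Product using (∃; -,_; proj₂; _,_)
  open import Data.Sum using (_⊎_; inj₁; inj₂; [_,_])
  open import Relation.Nullary using (¬_; yes; no; contradiction)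
  import Relation.Binary.PropositionalEquality as ≡
  open Field K hiding (zero)
  open import Relation.Binary.Reasoning.Setoid setoid
  open import Algebra.Solver.Ring.NaturalCoefficients.Default commutativeSemiring
    using (solve; _:+_; _:*_; _:=_)

  -- Hom n i: forms of degree i in n variables, written in Horner form in the
  -- first variable: p +x₀· q stands for p(x₁,…) + x₀ q(x₀,x₁,…).
  data Hom : ℕ → ℕ → Set c where
    κ      : Carrier → Hom 0 0
    0ᴴ     : ∀ {i} → Hom 0 (suc i)
    ↑_     : ∀ {n} → Hom n 0 → Hom (suc n) 0
    _+x₀·_ : ∀ {n i} → Hom n (suc i) → Hom (suc n) i → Hom (suc n) (suc i)

  infixr 5 _+x₀·_

  ⟦_⟧ : ∀ {n i} → Hom n i → Vector Carrier n → Carrier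
  ⟦ κ a ⟧      x = a
  ⟦ 0ᴴ ⟧       x = 0#
  ⟦ ↑ p ⟧      x = ⟦ p ⟧ (tail x)
  ⟦ p +x₀· q ⟧ x = ⟦ p ⟧ (tail x) + head x * ⟦ q ⟧ x

  zeroᴴ : ∀ {n i} → Hom n i
  zeroᴴ {zero}  {zero}  = κ 0#
  zeroᴴ {zero}  {suc i} = 0ᴴ
  zeroᴴ {suc n} {zero}  = ↑ zeroᴴ
  zeroᴴ {suc n} {suc i} = zeroᴴ +x₀· zeroᴴ

  constᴴ : ∀ {n} → Carrier → Hom n 0
  constᴴ {zero}  a = κ a
  constᴴ {suc n} a = ↑ constᴴ a

  constant : ∀ {n} → Hom n 0 → Carrier
  constant (κ a) = a
  constant (↑ p) = constant p

  _+ᴴ_ : ∀ {n i} → Hom n i → Hom n i → Hom n i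
  κ a      +ᴴ κ b      = κ (a + b)
  0ᴴ       +ᴴ 0ᴴ       = 0ᴴ
  (↑ p)    +ᴴ (↑ q)    = ↑ (p +ᴴ q)
  (p +x₀· q) +ᴴ (p′ +x₀· q′) = (p +ᴴ p′) +x₀· (q +ᴴ q′)

  _·ᴴ_ : ∀ {n i} → Carrier → Hom n i → Hom n i
  a ·ᴴ κ b      = κ (a * b)
  a ·ᴴ 0ᴴ       = 0ᴴ
  a ·ᴴ (↑ p)    = ↑ (a ·ᴴ p)
  a ·ᴴ (p +x₀· q) = (a ·ᴴ p) +x₀· (a ·ᴴ q)

  weaken : ∀ {n i} → Hom n i → Hom (suc n) i
  weaken {i = zero}  p = ↑ p
  weaken {i = suc i} p = p +x₀· zeroᴴ

  _*ᴸ_ : ∀ {m i} → Hom m 1 → Hom m i → Hom m (suc i)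
  _*ᴸ₀_ : ∀ {m i} → Hom m 1 → Hom (suc m) i → Hom (suc m) (suc i)
  0ᴴ             *ᴸ r = 0ᴴ
  (l +x₀· (↑ a)) *ᴸ r = (l *ᴸ₀ r) +ᴴ (zeroᴴ +x₀· (constant a ·ᴴ r))
  l *ᴸ₀ (↑ r)       = weaken (l *ᴸ r)
  l *ᴸ₀ (r +x₀· s)    = (l *ᴸ r) +x₀· (l *ᴸ₀ s)

  _∘ᴴ_ : ∀ {n m i} → Hom n i → (Fin n → Hom m 1) → Hom m i
  κ a        ∘ᴴ σ = constᴴ a
  0ᴴ         ∘ᴴ σ = zeroᴴ
  (↑ p)      ∘ᴴ σ = p ∘ᴴ tail σ
  (p +x₀· q) ∘ᴴ σ = (p ∘ᴴ tail σ) +ᴴ (head σ *ᴸ (q ∘ᴴ σ))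

  varᴴ : ∀ {n} → Fin n → Hom n 1
  varᴴ fzero    = zeroᴴ +x₀· constᴴ 1#
  varᴴ (fsuc k) = varᴴ k +x₀· zeroᴴ

  ⟦⟧-cong : ∀ {n i} (p : Hom n i) {x y : Vector Carrier n} → (∀ j → x j ≈ y j) → ⟦ p ⟧ x ≈ ⟦ p ⟧ y
  ⟦⟧-cong (κ a)      x≈y = refl
  ⟦⟧-cong 0ᴴ         x≈y = refl
  ⟦⟧-cong (↑ p)      x≈y = ⟦⟧-cong p (λ j → x≈y (fsuc j))
  ⟦⟧-cong (p +x₀· q) x≈y = +-cong (⟦⟧-cong p (λ j → x≈y (fsuc j))) (*-cong (x≈y fzero) (⟦⟧-cong q x≈y))

  ⟦zeroᴴ⟧ : ∀ {n i} x → ⟦ zeroᴴ {n} {i} ⟧ x ≈ 0#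
  ⟦zeroᴴ⟧ {zero}  {zero}  x = refl
  ⟦zeroᴴ⟧ {zero}  {suc i} x = refl
  ⟦zeroᴴ⟧ {suc n} {zero}  x = ⟦zeroᴴ⟧ (tail x)
  ⟦zeroᴴ⟧ {suc n} {suc i} x = begin
    ⟦ zeroᴴ {n} {suc i} ⟧ (tail x) + head x * ⟦ zeroᴴ {suc n} {i} ⟧ x
      ≈⟨ +-cong (⟦zeroᴴ⟧ {n} {suc i} (tail x)) (*-cong refl (⟦zeroᴴ⟧ {suc n} {i} x)) ⟩
    0# + head x * 0#  ≈⟨ +-identityˡ _ ⟩
    head x * 0#       ≈⟨ zeroʳ _ ⟩
    0#                ∎

  ⟦⟧≈constant : ∀ {n} (p : Hom n 0) x → ⟦ p ⟧ x ≈ constant p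
  ⟦⟧≈constant (κ a) x = refl
  ⟦⟧≈constant (↑ p) x = ⟦⟧≈constant p (tail x)

  constant-constᴴ : ∀ {n} a → constant (constᴴ {n} a) ≈ a
  constant-constᴴ {zero}  a = refl
  constant-constᴴ {suc n} a = constant-constᴴ {n} a

  ⟦constᴴ⟧ : ∀ {n} a x → ⟦ constᴴ {n} a ⟧ x ≈ a
  ⟦constᴴ⟧ {n} a x = trans (⟦⟧≈constant (constᴴ {n} a) x) (constant-constᴴ {n} a)

  ⟦+ᴴ⟧ : ∀ {n i} (p q : Hom n i) x → ⟦ p +ᴴ q ⟧ x ≈ ⟦ p ⟧ x + ⟦ q ⟧ x
  ⟦+ᴴ⟧ (κ a)      (κ b)        x = refl
  ⟦+ᴴ⟧ 0ᴴ         0ᴴ           x = sym (+-identityˡ _)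
  ⟦+ᴴ⟧ (↑ p)      (↑ q)        x = ⟦+ᴴ⟧ p q (tail x)
  ⟦+ᴴ⟧ (p +x₀· q) (p′ +x₀· q′) x = begin
    ⟦ p +ᴴ p′ ⟧ (tail x) + head x * ⟦ q +ᴴ q′ ⟧ x
      ≈⟨ +-cong (⟦+ᴴ⟧ p p′ (tail x)) (*-cong refl (⟦+ᴴ⟧ q q′ x)) ⟩
    (a + a′) + head x * (b + b′)
      ≈⟨ solve 5 (λ a a′ b b′ t → (a :+ a′) :+ t :* (b :+ b′) := (a :+ t :* b) :+ (a′ :+ t :* b′))
               refl a a′ b b′ (head x) ⟩
    (a + head x * b) + (a′ + head x * b′) ∎
    where a = ⟦ p ⟧ (tail x); a′ = ⟦ p′ ⟧ (tail x); b = ⟦ q ⟧ x; b′ = ⟦ q′ ⟧ x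

  ⟦·ᴴ⟧ : ∀ {n i} a (p : Hom n i) x → ⟦ a ·ᴴ p ⟧ x ≈ a * ⟦ p ⟧ x
  ⟦·ᴴ⟧ a (κ b)      x = refl
  ⟦·ᴴ⟧ a 0ᴴ         x = sym (zeroʳ _)
  ⟦·ᴴ⟧ a (↑ p)      x = ⟦·ᴴ⟧ a p (tail x)
  ⟦·ᴴ⟧ a (p +x₀· q) x = begin
    ⟦ a ·ᴴ p ⟧ (tail x) + head x * ⟦ a ·ᴴ q ⟧ x
      ≈⟨ +-cong (⟦·ᴴ⟧ a p (tail x)) (*-cong refl (⟦·ᴴ⟧ a q x)) ⟩
    a * b + head x * (a * b′)
      ≈⟨ solve 4 (λ a b b′ t → a :* b :+ t :* (a :* b′) := a :* (b :+ t :* b′)) refl a b b′ (head x) ⟩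
    a * (b + head x * b′) ∎
    where b = ⟦ p ⟧ (tail x); b′ = ⟦ q ⟧ x

  ⟦weaken⟧ : ∀ {n i} (p : Hom n i) x → ⟦ weaken p ⟧ x ≈ ⟦ p ⟧ (tail x)
  ⟦weaken⟧ {i = zero}  p x = refl
  ⟦weaken⟧ {n} {suc i} p x = begin
    ⟦ p ⟧ (tail x) + head x * ⟦ zeroᴴ {suc n} {i} ⟧ x  ≈⟨ +-cong refl (*-cong refl (⟦zeroᴴ⟧ {suc n} {i} x)) ⟩
    ⟦ p ⟧ (tail x) + head x * 0#                   ≈⟨ +-cong refl (zeroʳ _) ⟩
    ⟦ p ⟧ (tail x) + 0#                            ≈⟨ +-identityʳ _ ⟩
    ⟦ p ⟧ (tail x)                                 ∎

  ⟦*ᴸ⟧ : ∀ {m i} (l : Hom m 1) (r : Hom m i) x → ⟦ l *ᴸ r ⟧ x ≈ ⟦ l ⟧ x * ⟦ r ⟧ x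
  ⟦*ᴸ₀⟧ : ∀ {m i} (l : Hom m 1) (r : Hom (suc m) i) x → ⟦ l *ᴸ₀ r ⟧ x ≈ ⟦ l ⟧ (tail x) * ⟦ r ⟧ x
  ⟦*ᴸ⟧ 0ᴴ r x = sym (zeroˡ _)
  ⟦*ᴸ⟧ (l +x₀· (↑ a)) r x = begin
    ⟦ (l *ᴸ₀ r) +ᴴ (zeroᴴ +x₀· (constant a ·ᴴ r)) ⟧ x
      ≈⟨ ⟦+ᴴ⟧ (l *ᴸ₀ r) _ x ⟩
    ⟦ l *ᴸ₀ r ⟧ x + (⟦ zeroᴴ ⟧ (tail x) + head x * ⟦ constant a ·ᴴ r ⟧ x)
      ≈⟨ +-cong (⟦*ᴸ₀⟧ l r x) (+-cong (⟦zeroᴴ⟧ (tail x)) (*-cong refl (⟦·ᴴ⟧ _ r x))) ⟩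
    L * R + (0# + head x * (C * R))
      ≈⟨ +-cong refl (+-identityˡ _) ⟩
    L * R + head x * (C * R)
      ≈⟨ solve 4 (λ L R t C → L :* R :+ t :* (C :* R) := (L :+ t :* C) :* R) refl L R (head x) C ⟩
    (L + head x * C) * R
      ≈⟨ *-cong (+-cong refl (*-cong refl (sym (⟦⟧≈constant a (tail x))))) refl ⟩
    (L + head x * ⟦ a ⟧ (tail x)) * R ∎
    where L = ⟦ l ⟧ (tail x); R = ⟦ r ⟧ x; C = constant a
  ⟦*ᴸ₀⟧ l (↑ r) x = trans (⟦weaken⟧ (l *ᴸ r) x) (⟦*ᴸ⟧ l r (tail x))
  ⟦*ᴸ₀⟧ l (r +x₀· s) x = begin
    ⟦ l *ᴸ r ⟧ (tail x) + head x * ⟦ l *ᴸ₀ s ⟧ x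
      ≈⟨ +-cong (⟦*ᴸ⟧ l r (tail x)) (*-cong refl (⟦*ᴸ₀⟧ l s x)) ⟩
    L * A + head x * (L * B)
      ≈⟨ solve 4 (λ L A B t → L :* A :+ t :* (L :* B) := L :* (A :+ t :* B)) refl L A B (head x) ⟩
    L * (A + head x * B) ∎
    where L = ⟦ l ⟧ (tail x); A = ⟦ r ⟧ (tail x); B = ⟦ s ⟧ x

  ⟦∘ᴴ⟧ : ∀ {n m i} (p : Hom n i) (σ : Fin n → Hom m 1) z → ⟦ p ∘ᴴ σ ⟧ z ≈ ⟦ p ⟧ (λ j → ⟦ σ j ⟧ z)
  ⟦∘ᴴ⟧ (κ a)      σ z = ⟦constᴴ⟧ a z
  ⟦∘ᴴ⟧ 0ᴴ         σ z = ⟦zeroᴴ⟧ z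
  ⟦∘ᴴ⟧ (↑ p)      σ z = ⟦∘ᴴ⟧ p (tail σ) z
  ⟦∘ᴴ⟧ (p +x₀· q) σ z = begin
    ⟦ (p ∘ᴴ tail σ) +ᴴ (head σ *ᴸ (q ∘ᴴ σ)) ⟧ z
      ≈⟨ ⟦+ᴴ⟧ (p ∘ᴴ tail σ) _ z ⟩
    ⟦ p ∘ᴴ tail σ ⟧ z + ⟦ head σ *ᴸ (q ∘ᴴ σ) ⟧ z
      ≈⟨ +-cong (⟦∘ᴴ⟧ p (tail σ) z) (trans (⟦*ᴸ⟧ (head σ) _ z) (*-cong refl (⟦∘ᴴ⟧ q σ z))) ⟩
    ⟦ p ⟧ (λ j → ⟦ σ (fsuc j) ⟧ z) + ⟦ σ fzero ⟧ z * ⟦ q ⟧ (λ j → ⟦ σ j ⟧ z) ∎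

  ⟦varᴴ⟧ : ∀ {n} (k : Fin n) x → ⟦ varᴴ k ⟧ x ≈ x k
  ⟦varᴴ⟧ {suc n} fzero x = begin
    ⟦ zeroᴴ {n} {1} ⟧ (tail x) + head x * ⟦ constᴴ {suc n} 1# ⟧ x
      ≈⟨ +-cong (⟦zeroᴴ⟧ {n} {1} (tail x)) (*-cong refl (⟦constᴴ⟧ {suc n} 1# x)) ⟩
    0# + head x * 1#  ≈⟨ +-identityˡ _ ⟩
    head x * 1#       ≈⟨ *-identityʳ _ ⟩
    head x            ∎
  ⟦varᴴ⟧ {suc n} (fsuc k) x = begin
    ⟦ varᴴ k ⟧ (tail x) + head x * ⟦ zeroᴴ {suc n} {0} ⟧ x
      ≈⟨ +-cong (⟦varᴴ⟧ k (tail x)) (*-cong refl (⟦zeroᴴ⟧ {suc n} {0} x)) ⟩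
    x (fsuc k) + head x * 0#  ≈⟨ +-cong refl (zeroʳ _) ⟩
    x (fsuc k) + 0#           ≈⟨ +-identityʳ _ ⟩
    x (fsuc k)                ∎

  ⟦⟧-origin : ∀ {n i} (p : Hom n (suc i)) → ⟦ p ⟧ (λ _ → 0#) ≈ 0#
  ⟦⟧-origin 0ᴴ         = refl
  ⟦⟧-origin (p +x₀· q) = trans (+-cong (⟦⟧-origin p) (zeroˡ _)) (+-identityˡ _)

  Forms : ℕ → Set c
  Forms n = List (∃ (Hom n))

  IsRoot : ∀ {n i} → Vector Carrier n → Hom n i → Set ℓ
  IsRoot x p = ⟦ p ⟧ x ≈ 0#

  CommonRoot : ∀ {n} → Vector Carrier n → Forms n → Set (c ⊔ ℓ)
  CommonRoot x = All (λ f → IsRoot x (proj₂ f))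

  -- Writing P = ∑ₖ x₀ᵏ Pₖ(x′), lowerCoeffs P lists the Pₖ of positive degree and
  -- leadCoeff P is the constant coefficient of x₀^deg P.
  lowerCoeffs : ∀ {n i} → Hom (suc n) i → Forms n
  lowerCoeffs (↑ p)      = []
  lowerCoeffs (p +x₀· q) = (-, p) ∷ lowerCoeffs q

  leadCoeff : ∀ {n i} → Hom (suc n) i → Carrier
  leadCoeff (↑ p)      = constant p
  leadCoeff (p +x₀· q) = leadCoeff q

  ⟦⟧≈x₀^i*leadCoeff : ∀ {n i} (P : Hom (suc n) i) t z → CommonRoot z (lowerCoeffs P) →
                      ⟦ P ⟧ (t ◂ z) ≈ pow K t i * leadCoeff P
  ⟦⟧≈x₀^i*leadCoeff (↑ p) t z _ = trans (⟦⟧≈constant p z) (sym (*-identityˡ _))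
  ⟦⟧≈x₀^i*leadCoeff {i = suc i} (p +x₀· q) t z (p[z]≈0 ∷ roots) = begin
    ⟦ p ⟧ z + t * ⟦ q ⟧ (t ◂ z)          ≈⟨ +-cong p[z]≈0 (*-cong refl (⟦⟧≈x₀^i*leadCoeff q t z roots)) ⟩
    0# + t * (pow K t i * leadCoeff q)  ≈⟨ +-identityˡ _ ⟩
    t * (pow K t i * leadCoeff q)       ≈⟨ sym (*-assoc _ _ _) ⟩
    t * pow K t i * leadCoeff q         ∎

  x₀-free : ∀ {n i} → Hom (suc n) (suc i) → Hom n (suc i)
  x₀-free (p +x₀· q) = p

  x₀-quotient : ∀ {n i} → Hom (suc n) (suc i) → Hom (suc n) i
  x₀-quotient (p +x₀· q) = q

  ⟦⟧≈x₀-free+leadCoeff*x₀^i : ∀ {n i} (P : Hom (suc n) (suc i)) t z → CommonRoot z (lowerCoeffs (x₀-quotient P)) →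
                              ⟦ P ⟧ (t ◂ z) ≈ ⟦ x₀-free P ⟧ z + leadCoeff P * pow K t (suc i)
  ⟦⟧≈x₀-free+leadCoeff*x₀^i {i = i} (p +x₀· q) t z roots = +-cong refl (begin
    t * ⟦ q ⟧ (t ◂ z)                ≈⟨ *-cong refl (⟦⟧≈x₀^i*leadCoeff q t z roots) ⟩
    t * (pow K t i * leadCoeff q)    ≈⟨ solve 3 (λ t p l → t :* (p :* l) := l :* (t :* p)) refl t (pow K t i) (leadCoeff q) ⟩
    leadCoeff q * (t * pow K t i)    ∎)

  lowerCoeffs-roots : ∀ {n i} (P : Hom (suc n) (suc i)) {z} → IsRoot z (x₀-free P) →
                      CommonRoot z (lowerCoeffs (x₀-quotient P)) → CommonRoot z (lowerCoeffs P)
  lowerCoeffs-roots (p +x₀· q) root roots = root ∷ roots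

  lowerCoeffs-origin : ∀ {n i} (P : Hom (suc n) i) → CommonRoot (λ _ → 0#) (lowerCoeffs P)
  lowerCoeffs-origin (↑ p)      = []
  lowerCoeffs-origin (p +x₀· q) = ⟦⟧-origin p ∷ lowerCoeffs-origin q

  x*y≈0⇒x≈0 : ∀ {x y} → ¬ (y ≈ 0#) → x * y ≈ 0# → x ≈ 0#
  x*y≈0⇒x≈0 {x} {y} y≉0 xy≈0 with inverse y y≉0
  ... | y⁻¹ , yy⁻¹≈1 = begin
    x               ≈⟨ sym (*-identityʳ x) ⟩
    x * 1#          ≈⟨ *-cong refl (sym yy⁻¹≈1) ⟩
    x * (y * y⁻¹)   ≈⟨ sym (*-assoc x y y⁻¹) ⟩
    (x * y) * y⁻¹   ≈⟨ *-cong xy≈0 refl ⟩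
    0# * y⁻¹        ≈⟨ zeroˡ y⁻¹ ⟩
    0#              ∎

  pow-1# : ∀ i → pow K 1# i ≈ 1#
  pow-1# zero    = refl
  pow-1# (suc i) = trans (*-identityˡ _) (pow-1# i)

  module Line {n} (y : Vector Carrier (suc n)) (c : Fin (suc n)) where

    embed : Vector Carrier n → Vector Carrier (suc n)
    embed z j with c Fin.≟ j
    ... | yes _  = 0#
    ... | no c≢j = z (Fin.punchOut c≢j)

    point : Carrier → Vector Carrier n → Vector Carrier (suc n)
    point t z j = t * y j + embed z j

    coordinate : Fin (suc n) → Hom (suc n) 1
    coordinate j with c Fin.≟ j
    ... | yes _  = zeroᴴ +x₀· constᴴ (y j)
    ... | no c≢j = varᴴ (Fin.punchOut c≢j) +x₀· constᴴ (y j)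

    ⟦coordinate⟧ : ∀ j t z → ⟦ coordinate j ⟧ (t ◂ z) ≈ point t z j
    ⟦coordinate⟧ j t z with c Fin.≟ j
    ... | yes _ = begin
      ⟦ zeroᴴ {n} {1} ⟧ z + t * ⟦ constᴴ {n} (y j) ⟧ z  ≈⟨ +-cong (⟦zeroᴴ⟧ {n} {1} z) (*-cong refl (⟦constᴴ⟧ (y j) z)) ⟩
      0# + t * y j                                      ≈⟨ +-comm _ _ ⟩
      t * y j + 0#                                      ∎
    ... | no c≢j = begin
      ⟦ varᴴ (Fin.punchOut c≢j) ⟧ z + t * ⟦ constᴴ {n} (y j) ⟧ z
        ≈⟨ +-cong (⟦varᴴ⟧ (Fin.punchOut c≢j) z) (*-cong refl (⟦constᴴ⟧ (y j) z)) ⟩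
      z (Fin.punchOut c≢j) + t * y j  ≈⟨ +-comm _ _ ⟩
      t * y j + z (Fin.punchOut c≢j)  ∎

    restrict : ∀ {i} → Hom (suc n) i → Hom (suc n) i
    restrict G = G ∘ᴴ coordinate

    ⟦restrict⟧ : ∀ {i} (G : Hom (suc n) i) t z → ⟦ restrict G ⟧ (t ◂ z) ≈ ⟦ G ⟧ (point t z)
    ⟦restrict⟧ G t z = trans (⟦∘ᴴ⟧ G coordinate (t ◂ z)) (⟦⟧-cong G (λ j → ⟦coordinate⟧ j t z))

    embed-origin : ∀ j → embed (λ _ → 0#) j ≈ 0#
    embed-origin j with c Fin.≟ j
    ... | yes _ = refl
    ... | no _  = refl

    point-1-origin : ∀ j → point 1# (λ _ → 0#) j ≈ y j
    point-1-origin j = trans (+-cong (*-identityˡ _) (embed-origin j)) (+-identityʳ _)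

    -- Evaluate the restriction at t = 1, z = 0, where all lower coefficients vanish.
    leadCoeff-restrict : ∀ {i} (G : Hom (suc n) i) → leadCoeff (restrict G) ≈ ⟦ G ⟧ y
    leadCoeff-restrict {i} G = begin
      leadCoeff (restrict G)                 ≈⟨ sym (*-identityˡ _) ⟩
      1# * leadCoeff (restrict G)            ≈⟨ *-cong (sym (pow-1# i)) refl ⟩
      pow K 1# i * leadCoeff (restrict G)    ≈⟨ sym (⟦⟧≈x₀^i*leadCoeff (restrict G) 1# _ (lowerCoeffs-origin _)) ⟩
      ⟦ restrict G ⟧ (1# ◂ (λ _ → 0#))       ≈⟨ ⟦restrict⟧ G 1# (λ _ → 0#) ⟩
      ⟦ G ⟧ (point 1# (λ _ → 0#))            ≈⟨ ⟦⟧-cong G point-1-origin ⟩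
      ⟦ G ⟧ y                                ∎

    root-point : ∀ {i} (G : Hom (suc n) i) t z → IsRoot y G → CommonRoot z (lowerCoeffs (restrict G)) →
                 IsRoot (point t z) G
    root-point {i} G t z G[y]≈0 roots = begin
      ⟦ G ⟧ (point t z)                      ≈⟨ sym (⟦restrict⟧ G t z) ⟩
      ⟦ restrict G ⟧ (t ◂ z)                 ≈⟨ ⟦⟧≈x₀^i*leadCoeff (restrict G) t z roots ⟩
      pow K t i * leadCoeff (restrict G)     ≈⟨ *-cong refl (trans (leadCoeff-restrict G) G[y]≈0) ⟩
      pow K t i * 0#                         ≈⟨ zeroʳ _ ⟩
      0#                                     ∎

    embed-c : ∀ z → embed z c ≈ 0#
    embed-c z with c Fin.≟ c
    ... | yes _  = refl
    ... | no c≢c = contradiction ≡.refl c≢c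

    embed-punchIn : ∀ z j → embed z (Fin.punchIn c j) ≈ z j
    embed-punchIn z j with c Fin.≟ Fin.punchIn c j
    ... | yes c≡ = contradiction (≡.sym c≡) (punchInᵢ≢i c j)
    ... | no c≢  = reflexive (≡.cong z (≡.trans (punchOut-cong c ≡.refl) (punchOut-punchIn c)))

    point-nonTrivial : ∀ z {m} (t : Vector Carrier (suc m)) → ¬ (y c ≈ 0#) →
                       NonTrivial K z ⊎ NonTrivial K t →
                       ¬ ¬ (NonTrivial K (point (head t) z) ⊎ NonTrivial K (tail t))
    point-nonTrivial z t y[c]≉0 nonTrivial ¬goal = ¬goal (inj₁ (c , point[c]≉0))
      where
        t₀≉0 : ¬ (head t ≈ 0#)
        t₀≉0 t₀≈0 = [ z-case , t-case ] nonTrivial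
          where
            z-case : NonTrivial K z → _
            z-case (j , z[j]≉0) = ¬goal (inj₁ (Fin.punchIn c j , λ e → z[j]≉0 (begin
              z j                                         ≈⟨ sym (embed-punchIn z j) ⟩
              embed z (Fin.punchIn c j)                   ≈⟨ sym (+-identityˡ _) ⟩
              0# + embed z (Fin.punchIn c j)              ≈⟨ +-cong (sym (trans (*-cong t₀≈0 refl) (zeroˡ _))) refl ⟩
              point (head t) z (Fin.punchIn c j)          ≈⟨ e ⟩
              0#                                          ∎)))
            t-case : NonTrivial K t → _
            t-case (fzero  , t₀≉0)   = t₀≉0 t₀≈0
            t-case (fsuc j , t[j]≉0) = ¬goal (inj₂ (j , t[j]≉0))
        point[c]≉0 : ¬ (point (head t) z c ≈ 0#)
        point[c]≉0 e = t₀≉0 (x*y≈0⇒x≈0 y[c]≉0 (trans (sym (+-identityʳ _)) (trans (+-cong refl (sym (embed-c z))) e)))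

    -- Each diagonalisation step moves the leading coefficient of F along the line
    -- into a new diagonal term.
    diagonal-point : ∀ {D} (F : Hom (suc n) (suc D)) z {m} (a : Vector Carrier m) (t : Vector Carrier (suc m)) →
      CommonRoot z (lowerCoeffs (x₀-quotient (restrict F))) →
      ⟦ x₀-free (restrict F) ⟧ z + diagEval K (suc D) (leadCoeff (restrict F) ◂ a) t ≈ 0# →
      ⟦ F ⟧ (point (head t) z) + diagEval K (suc D) a (tail t) ≈ 0#
    diagonal-point {D} F z a t roots root = begin
      ⟦ F ⟧ (point (head t) z) + Δ        ≈⟨ +-cong (sym (⟦restrict⟧ F (head t) z)) refl ⟩
      ⟦ restrict F ⟧ (head t ◂ z) + Δ     ≈⟨ +-cong (⟦⟧≈x₀-free+leadCoeff*x₀^i (restrict F) (head t) z roots) refl ⟩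
      (F₀ + leadCoeff (restrict F) * pow K (head t) (suc D)) + Δ  ≈⟨ +-assoc _ _ _ ⟩
      F₀ + diagEval K (suc D) (leadCoeff (restrict F) ◂ a) t    ≈⟨ root ⟩
      0#                                  ∎
      where
        F₀ = ⟦ x₀-free (restrict F) ⟧ z
        Δ = diagEval K (suc D) a (tail t)

module DiagonalForms {c ℓ : Level} (K : Field c ℓ) where
  open import Data.Nat using (ℕ; zero; suc; _≤_; z≤n; s≤s)
  open import Data.Nat.Properties using (<-irrefl)
  open import Data.Fin using (Fin) renaming (zero to fzero; suc to fsuc)
  open import Data.Vec.Functional using (Vector) renaming (_∷_ to _◂_)
  open import Data.Product using (_,_)
  open import Relation.Nullary using (¬_)
  import Relation.Binary.PropositionalEquality as ≡
  open Field K hiding (zero)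
  open import Relation.Binary.Reasoning.Setoid setoid
  open import Algebra.Properties.Ring ring using (-‿distribʳ-*)
  open Horner K using (pow-1#)
  open Arithmetic.Bounds using (diagonalBound)

  unitVector : ∀ {m} → Fin m → Vector Carrier m
  unitVector fzero    = 1# ◂ (λ _ → 0#)
  unitVector (fsuc j) = 0# ◂ unitVector j

  unitVector-nonTrivial : ∀ {m} (j : Fin m) → NonTrivial K (unitVector j)
  unitVector-nonTrivial fzero    = fzero , λ 1≈0 → 0≉1 (sym 1≈0)
  unitVector-nonTrivial (fsuc j) with unitVector-nonTrivial j
  ... | k , ≉0 = fsuc k , ≉0

  diagEval-origin : ∀ {m} i (a : Vector Carrier m) → diagEval K (suc i) a (λ _ → 0#) ≈ 0#
  diagEval-origin {zero}  i a = refl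
  diagEval-origin {suc m} i a =
    trans (+-cong (trans (*-cong refl (zeroˡ _)) (zeroʳ _)) (diagEval-origin i (λ t → a (fsuc t)))) (+-identityˡ _)

  diagEval-unitVector : ∀ {m} i (a : Vector Carrier m) j → diagEval K (suc i) a (unitVector j) ≈ a j
  diagEval-unitVector i a fzero =
    trans (+-cong (trans (*-cong refl (pow-1# (suc i))) (*-identityʳ _)) (diagEval-origin i (λ t → a (fsuc t))))
          (+-identityʳ _)
  diagEval-unitVector i a (fsuc j) =
    trans (+-cong (trans (*-cong refl (zeroˡ _)) (zeroʳ _)) (diagEval-unitVector i (λ t → a (fsuc t)) j))
          (+-identityˡ _)

  anisotropic⇒coefficient≉0 : ∀ {m} i (a : Vector Carrier m) → DiagNoZero K (suc i) a → ∀ j → ¬ (a j ≈ 0#)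
  anisotropic⇒coefficient≉0 i a anisotropic j a[j]≈0 =
    anisotropic (unitVector j , unitVector-nonTrivial j , trans (diagEval-unitVector i a j) a[j]≈0)

  x₀-anisotropic : DiagNoZero K 1 (λ (_ : Fin 1) → 1#)
  x₀-anisotropic (t , (fzero , t₀≉0) , root) = t₀≉0 (begin
    t fzero                      ≈⟨ sym (*-identityʳ _) ⟩
    t fzero * 1#                 ≈⟨ sym (*-identityˡ _) ⟩
    1# * (t fzero * 1#)          ≈⟨ sym (+-identityʳ _) ⟩
    1# * (t fzero * 1#) + 0#     ≈⟨ root ⟩
    0#                           ∎)

  module _ {d M : ℕ} (ψ≤M : ψ≤ K d M) where

    1≤M : 1 ≤ d → 1 ≤ M
    1≤M 1≤d = ψ≤M 1 (s≤s z≤n) 1≤d 1 (λ _ → 1#) x₀-anisotropic 1 (λ t → t) (λ eq → eq) (λ _ 1≈0 → 0≉1 (sym 1≈0))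

    isotropic : ∀ D → 1 ≤ D → D ≤ d → (a : Vector Carrier (suc (diagonalBound M D))) → ¬ DiagNoZero K D a
    isotropic (suc zero) _ _ a anisotropic = anisotropic (t , (fzero , t₀≉0) , root)
      where
        a₀ = a fzero
        a₁ = a (fsuc fzero)
        t : Vector Carrier 2
        t = a₁ ◂ (- a₀) ◂ (λ ())
        t₀≉0 : ¬ (a₁ ≈ 0#)
        t₀≉0 = anisotropic⇒coefficient≉0 0 a anisotropic (fsuc fzero)
        root : diagEval K 1 a t ≈ 0#
        root = begin
          a₀ * (a₁ * 1#) + (a₁ * (- a₀ * 1#) + 0#)
            ≈⟨ +-cong (*-cong refl (*-identityʳ _)) (trans (+-identityʳ _) (*-cong refl (*-identityʳ _))) ⟩
          a₀ * a₁ + a₁ * - a₀       ≈⟨ +-cong (*-comm _ _) (sym (-‿distribʳ-* _ _)) ⟩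
          a₁ * a₀ + - (a₁ * a₀)     ≈⟨ -‿inverseʳ _ ⟩
          0#                        ∎
    isotropic (suc (suc D)) 1≤D D≤d a anisotropic =
      <-irrefl ≡.refl (ψ≤M (suc (suc D)) 1≤D D≤d (suc M) a anisotropic (suc M) (λ t → t) (λ eq → eq)
                         (anisotropic⇒coefficient≉0 (suc D) a anisotropic))

module Counting {c ℓ : Level} (K : Field c ℓ) where
  open import Data.Nat hiding (NonTrivial; _⊔_)
  open import Data.Nat.Properties
  open import Algebra.Properties.CommutativeSemigroup +-commutativeSemigroup using (interchange)
  open import Data.Vec.Functional using (Vector)
  open import Data.List using (List; []; _∷_; _++_; length)
  open import Data.List.Relation.Unary.All using (All; []; _∷_)
  open import Data.Product using (Σ; _×_; _,_; proj₁)
  open import Relation.Nullary using (¬_; yes; no)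
  open import Relation.Binary.PropositionalEquality using (_≡_; refl; sym; trans; cong; cong₂; subst)
  open Field K using (Carrier; 0#)
  open Horner K
  open Arithmetic

  #deg : ∀ {n} → ℕ → Forms n → ℕ
  #deg j []            = 0
  #deg j ((i , _) ∷ S) = 𝟙[ i ≡ j ] + #deg j S

  #deg≥ : ∀ {n} → ℕ → Forms n → ℕ
  #deg≥ j []            = 0
  #deg≥ j ((i , _) ∷ S) = 𝟙[ j ≤ i ] + #deg≥ j S

  #deg-++ : ∀ {n} j (S S′ : Forms n) → #deg j (S ++ S′) ≡ #deg j S + #deg j S′
  #deg-++ j []            S′ = refl
  #deg-++ j ((i , _) ∷ S) S′ = trans (cong (𝟙[ i ≡ j ] +_) (#deg-++ j S S′)) (sym (+-assoc 𝟙[ i ≡ j ] _ _))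

  #deg≥-split : ∀ {n} j (S : Forms n) → #deg≥ j S ≡ #deg j S + #deg≥ (suc j) S
  #deg≥-split j []            = refl
  #deg≥-split j ((i , _) ∷ S) = trans (cong₂ _+_ (𝟙[j≤i]-split j i) (#deg≥-split j S)) (interchange 𝟙[ i ≡ j ] 𝟙[ suc j ≤ i ] (#deg j S) (#deg≥ (suc j) S))

  Degrees≤ : ∀ {n} → ℕ → Forms n → Set c
  Degrees≤ D = All (λ f → 1 ≤ proj₁ f × proj₁ f ≤ D)

  Shape : ∀ {n} → ℕ → ℕ → Forms n → Set c
  Shape D ρ S = Degrees≤ D S × (∀ m → m < D → #deg (D ∸ m) S ≤ ρ ^ (2 ^ m))

  #deg≥-beyond : ∀ {n} D (S : Forms n) → Degrees≤ D S → #deg≥ (suc D) S ≡ 0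
  #deg≥-beyond D []            _                = refl
  #deg≥-beyond D ((i , _) ∷ S) ((_ , i≤D) ∷ degs) = cong₂ _+_ (𝟙[j≤i]≡0 (s≤s i≤D)) (#deg≥-beyond D S degs)

  #deg≥≤squaringSum : ∀ {n} D g (S : Forms n) → Shape D g S → ∀ m → m < D → #deg≥ (D ∸ m) S ≤ squaringSum m g
  #deg≥≤squaringSum D g S (degs , counts) zero    m<D = begin
    #deg≥ D S                   ≡⟨ #deg≥-split D S ⟩
    #deg D S + #deg≥ (suc D) S  ≡⟨ cong (#deg D S +_) (#deg≥-beyond D S degs) ⟩
    #deg D S + 0                ≡⟨ +-identityʳ _ ⟩
    #deg D S                    ≤⟨ counts 0 m<D ⟩
    g ^ 1                       ≡⟨ *-identityʳ g ⟩
    g                           ∎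
    where open ≤-Reasoning
  #deg≥≤squaringSum D g S shape@(_ , counts) (suc m) m<D = begin
    #deg≥ (D ∸ suc m) S                            ≡⟨ #deg≥-split (D ∸ suc m) S ⟩
    #deg (D ∸ suc m) S + #deg≥ (suc (D ∸ suc m)) S ≡⟨ cong (λ j → #deg (D ∸ suc m) S + #deg≥ j S) (sym (+-∸-assoc 1 (<⇒≤ m<D))) ⟩
    #deg (D ∸ suc m) S + #deg≥ (D ∸ m) S           ≤⟨ +-mono-≤ (counts (suc m) m<D) (#deg≥≤squaringSum D g S shape m (<-trans (n<1+n m) m<D)) ⟩
    g ^ (2 ^ suc m) + squaringSum m g              ∎
    where open ≤-Reasoning

  #deg-lowerCoeffs : ∀ {n i} (P : Hom (suc n) i) j → #deg (suc j) (lowerCoeffs P) ≡ 𝟙[ suc j ≤ i ]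
  #deg-lowerCoeffs (↑ p)                 j = refl
  #deg-lowerCoeffs {i = suc i} (p +x₀· q) j =
    trans (cong (𝟙[ suc i ≡ suc j ] +_) (#deg-lowerCoeffs q j)) (sym (𝟙[j≤i]-split (suc j) (suc i)))

  lowerCoeffs-degrees : ∀ {n i} (P : Hom (suc n) i) {D} → i ≤ D → Degrees≤ D (lowerCoeffs P)
  lowerCoeffs-degrees (↑ p)                 _   = []
  lowerCoeffs-degrees {i = suc i} (p +x₀· q) i<D = (s≤s z≤n , i<D) ∷ lowerCoeffs-degrees q (<⇒≤ i<D)

  origin-roots : ∀ {n} D (S : Forms n) → Degrees≤ D S → CommonRoot (λ _ → 0#) S
  origin-roots D []                  _               = []
  origin-roots D ((suc i , G) ∷ S) (_ ∷ degs) = ⟦⟧-origin G ∷ origin-roots D S degs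

  origin-roots-top : ∀ {n i} (T : List (Hom n (suc i))) → All (IsRoot (λ _ → 0#)) T
  origin-roots-top []      = []
  origin-roots-top (G ∷ T) = ⟦⟧-origin G ∷ origin-roots-top T

  -- Double negated: isotropy of diagonal forms is only available in this form from ψ ≤ M.
  HasRoot : ∀ {n} → Forms n → Set (c ⊔ ℓ)
  HasRoot {n} S = ¬ ¬ (Σ (Vector Carrier n) λ x → NonTrivial K x × CommonRoot x S)

  HasRootWith : ∀ {n i} → List (Hom n i) → Forms n → Set (c ⊔ ℓ)
  HasRootWith {n} T S = ¬ ¬ (Σ (Vector Carrier n) λ x → NonTrivial K x × All (IsRoot x) T × CommonRoot x S)

  record TopSplit {N} (D : ℕ) (S : Forms N) : Set (c ⊔ ℓ) where
    field
      top          : List (Hom N (suc D))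
      rest         : Forms N
      rest-degrees : Degrees≤ D rest
      length-top   : length top ≤ #deg (suc D) S
      #deg-rest    : ∀ j → #deg j rest ≤ #deg j S
      roots        : ∀ x → All (IsRoot x) top → CommonRoot x rest → CommonRoot x S

  topSplit : ∀ {N} D (S : Forms N) → Degrees≤ (suc D) S → TopSplit D S
  topSplit D [] _ = record
    { top = [] ; rest = [] ; rest-degrees = [] ; length-top = z≤n ; #deg-rest = λ _ → z≤n ; roots = λ _ _ _ → [] }
  topSplit D ((i , G) ∷ S) ((1≤i , i≤1+D) ∷ degs) with i ≟ suc D | topSplit D S degs
  ... | yes refl | split = record
    { top = G ∷ top ; rest = rest ; rest-degrees = rest-degrees
    ; length-top = subst (λ k → suc (length top) ≤ k + #deg (suc D) S) (sym (𝟙[i≡i] (suc D))) (s≤s length-top)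
    ; #deg-rest = λ j → ≤-trans (#deg-rest j) (m≤n+m _ _)
    ; roots = λ { x (G[x] ∷ top[x]) rest[x] → G[x] ∷ roots x top[x] rest[x] } }
    where open TopSplit split
  ... | no i≢1+D | split = record
    { top = top ; rest = (i , G) ∷ rest ; rest-degrees = (1≤i , ≤-pred (≤∧≢⇒< i≤1+D i≢1+D)) ∷ rest-degrees
    ; length-top = ≤-trans length-top (m≤n+m _ _)
    ; #deg-rest = λ j → +-monoʳ-≤ 𝟙[ i ≡ j ] (#deg-rest j)
    ; roots = λ { x top[x] (G[x] ∷ rest[x]) → G[x] ∷ roots x top[x] rest[x] } }
    where open TopSplit split


module CommonRoots {c ℓ : Level} (K : Field c ℓ) {d M : ℕ} (ψ≤M : ψ≤ K d M) where
  open import Data.Nat hiding (NonTrivial; _⊔_)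
  open import Data.Nat.Properties
  open import Data.Fin using (Fin) renaming (zero to fzero)
  open import Data.Vec.Functional using (Vector; head; tail) renaming (_∷_ to _◂_)
  open import Data.List using (List; []; _∷_; _++_; map; length)
  open import Data.List.Properties using (length-map)
  open import Data.List.Relation.Unary.All using (All; []; _∷_)
  open import Data.List.Relation.Unary.All.Properties using (++⁺; ++⁻)
  open import Data.Product using (Σ; _×_; _,_)
  open import Data.Sum using (_⊎_; inj₁; inj₂)
  open import Relation.Nullary using (¬_)
  open import Relation.Binary.PropositionalEquality using (_≡_; refl; sym; trans; cong; cong₂; subst)
  open Field K using (Carrier; _≈_; 0#)
  module FK = Field K
  open Horner K
  open DiagonalForms K using (unitVector; unitVector-nonTrivial; isotropic; 1≤M)
  open Arithmetic
  open Bounds M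
  open Counting K
  module Restriction {n} (y : Vector Carrier (suc n)) (c : Fin (suc n)) (D : ℕ) where
    open Line y c

    restrictTop : List (Hom (suc n) (suc D)) → List (Hom n (suc D))
    restrictTop = map (λ G → x₀-free (restrict G))

    topLowerCoeffs : List (Hom (suc n) (suc D)) → Forms n
    topLowerCoeffs []      = []
    topLowerCoeffs (G ∷ T) = lowerCoeffs (x₀-quotient (restrict G)) ++ topLowerCoeffs T

    restLowerCoeffs : Forms (suc n) → Forms n
    restLowerCoeffs []            = []
    restLowerCoeffs ((_ , G) ∷ L) = lowerCoeffs (restrict G) ++ restLowerCoeffs L

    nextRest : Forms (suc n) → List (Hom (suc n) (suc D)) → Hom (suc n) (suc D) → Forms n
    nextRest L T F = restLowerCoeffs L ++ topLowerCoeffs T ++ lowerCoeffs (x₀-quotient (restrict F))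

    #deg-restLowerCoeffs : ∀ L j → #deg (suc j) (restLowerCoeffs L) ≡ #deg≥ (suc j) L
    #deg-restLowerCoeffs []            j = refl
    #deg-restLowerCoeffs ((_ , G) ∷ L) j = trans (#deg-++ (suc j) (lowerCoeffs (restrict G)) _)
      (cong₂ _+_ (#deg-lowerCoeffs (restrict G) j) (#deg-restLowerCoeffs L j))

    #deg-topLowerCoeffs : ∀ T j → #deg (suc j) (topLowerCoeffs T) ≤ length T
    #deg-topLowerCoeffs []      j = z≤n
    #deg-topLowerCoeffs (G ∷ T) j = begin
      #deg (suc j) (lowerCoeffs P ++ topLowerCoeffs T)           ≡⟨ #deg-++ (suc j) (lowerCoeffs P) _ ⟩
      #deg (suc j) (lowerCoeffs P) + #deg (suc j) (topLowerCoeffs T) ≡⟨ cong (_+ _) (#deg-lowerCoeffs P j) ⟩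
      𝟙[ suc j ≤ D ] + #deg (suc j) (topLowerCoeffs T)          ≤⟨ +-mono-≤ (𝟙[j≤i]≤1 (suc j) D) (#deg-topLowerCoeffs T j) ⟩
      suc (length T)                                            ∎
      where
        open ≤-Reasoning
        P = x₀-quotient (restrict G)

    -- Each form of L of degree ≥ j contributes one coefficient of degree j, each top form at most one.
    #deg-nextRest : ∀ L T F j → #deg (suc j) (nextRest L T F) ≤ #deg≥ (suc j) L + suc (length T)
    #deg-nextRest L T F j = begin
      #deg (suc j) (nextRest L T F)
        ≡⟨ #deg-++ (suc j) (restLowerCoeffs L) _ ⟩
      #deg (suc j) (restLowerCoeffs L) + #deg (suc j) (topLowerCoeffs T ++ lowerCoeffs P)
        ≡⟨ cong₂ _+_ (#deg-restLowerCoeffs L j) (#deg-++ (suc j) (topLowerCoeffs T) _) ⟩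
      #deg≥ (suc j) L + (#deg (suc j) (topLowerCoeffs T) + #deg (suc j) (lowerCoeffs P))
        ≤⟨ +-monoʳ-≤ (#deg≥ (suc j) L) (+-mono-≤ (#deg-topLowerCoeffs T j)
                                                 (≤-trans (≤-reflexive (#deg-lowerCoeffs P j)) (𝟙[j≤i]≤1 (suc j) D))) ⟩
      #deg≥ (suc j) L + (length T + 1)
        ≡⟨ cong (#deg≥ (suc j) L +_) (+-comm (length T) 1) ⟩
      #deg≥ (suc j) L + suc (length T) ∎
      where
        open ≤-Reasoning
        P = x₀-quotient (restrict F)

    restLowerCoeffs-degrees : ∀ L → Degrees≤ D L → Degrees≤ D (restLowerCoeffs L)
    restLowerCoeffs-degrees []            _                  = []
    restLowerCoeffs-degrees ((_ , G) ∷ L) ((_ , i≤D) ∷ degs) =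
      ++⁺ (lowerCoeffs-degrees (restrict G) i≤D) (restLowerCoeffs-degrees L degs)

    topLowerCoeffs-degrees : ∀ T → Degrees≤ D (topLowerCoeffs T)
    topLowerCoeffs-degrees []      = []
    topLowerCoeffs-degrees (G ∷ T) = ++⁺ (lowerCoeffs-degrees (x₀-quotient (restrict G)) ≤-refl) (topLowerCoeffs-degrees T)

    nextRest-shape : ∀ g L T F → Shape D g L → Shape D (g + suc (length T)) (nextRest L T F)
    nextRest-shape g L T F shape@(degs , _) =
      ++⁺ (restLowerCoeffs-degrees L degs) (++⁺ (topLowerCoeffs-degrees T) (lowerCoeffs-degrees (x₀-quotient (restrict F)) ≤-refl)) ,
      λ m m<D → subst (λ j → #deg j (nextRest L T F) ≤ (g + suc (length T)) ^ (2 ^ m)) (sym (+-∸-assoc 1 m<D)) (begin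
        #deg (suc (D ∸ suc m)) (nextRest L T F)         ≤⟨ #deg-nextRest L T F (D ∸ suc m) ⟩
        #deg≥ (suc (D ∸ suc m)) L + suc (length T)      ≡⟨ cong (λ j → #deg≥ j L + suc (length T)) (sym (+-∸-assoc 1 m<D)) ⟩
        #deg≥ (D ∸ m) L + suc (length T)                ≤⟨ +-monoˡ-≤ (suc (length T)) (#deg≥≤squaringSum D g L shape m m<D) ⟩
        squaringSum m g + suc (length T)                ≤⟨ squaringSum+n≤[m+n]^2^k m g (suc (length T)) (s≤s z≤n) ⟩
        (g + suc (length T)) ^ (2 ^ m)                  ∎)
      where open ≤-Reasoning

    restLowerCoeffs-roots : ∀ L t z → CommonRoot y L → CommonRoot z (restLowerCoeffs L) → CommonRoot (point t z) L
    restLowerCoeffs-roots []            t z _ _ = []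
    restLowerCoeffs-roots ((_ , G) ∷ L) t z (G[y] ∷ L[y]) roots with ++⁻ (lowerCoeffs (restrict G)) roots
    ... | G-roots , L-roots = root-point G t z G[y] G-roots ∷ restLowerCoeffs-roots L t z L[y] L-roots

    topLowerCoeffs-roots : ∀ T t z → All (IsRoot y) T → CommonRoot z (topLowerCoeffs T) →
                           All (IsRoot z) (restrictTop T) → All (IsRoot (point t z)) T
    topLowerCoeffs-roots []      t z _ _ _ = []
    topLowerCoeffs-roots (G ∷ T) t z (G[y] ∷ T[y]) roots (G₀[z] ∷ T₀[z]) with ++⁻ (lowerCoeffs (x₀-quotient (restrict G))) roots
    ... | G-roots , T-roots =
      root-point G t z G[y] (lowerCoeffs-roots (restrict G) G₀[z] G-roots) ∷ topLowerCoeffs-roots T t z T[y] T-roots T₀[z]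

  DiagonalGoal : ∀ {N k D} → Hom N (suc D) → List (Hom N (suc D)) → Forms N → Vector Carrier k → Set (c ⊔ ℓ)
  DiagonalGoal {N} {k} {D} F T L a = ¬ ¬ (Σ (Vector Carrier N) λ x → Σ (Vector Carrier k) λ t →
    (NonTrivial K x ⊎ NonTrivial K t) × All (IsRoot x) T × CommonRoot x L ×
    (⟦ F ⟧ x FK.+ diagEval K (suc D) a t) ≈ 0#)

  diagonalGoal-restrict : ∀ {n k D} (y : Vector Carrier (suc n)) c → ¬ (y c ≈ 0#) →
    ∀ (F : Hom (suc n) (suc D)) T L (a : Vector Carrier k) → All (IsRoot y) T → CommonRoot y L →
    DiagonalGoal (x₀-free (Line.restrict y c F)) (Restriction.restrictTop y c D T) (Restriction.nextRest y c D L T F)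
                 (leadCoeff (Line.restrict y c F) ◂ a) →
    DiagonalGoal F T L a
  diagonalGoal-restrict {D = D} y c y[c]≉0 F T L a T[y] L[y] goal ¬goal =
    goal λ (z , t , nonTrivial , T₀[z] , rest[z] , root) →
      let L-roots , rest′ = ++⁻ (restLowerCoeffs L) rest[z]
          T-roots , F-roots = ++⁻ (topLowerCoeffs T) rest′
      in point-nonTrivial z t y[c]≉0 nonTrivial λ nonTrivial′ →
           ¬goal (point (head t) z , tail t , nonTrivial′ ,
                  topLowerCoeffs-roots T (head t) z T[y] T-roots T₀[z] ,
                  restLowerCoeffs-roots L (head t) z L[y] L-roots ,
                  diagonal-point F z a t F-roots root)
    where
      open Line y c
      open Restriction y c D

  Solvable : ℕ → Set (c ⊔ ℓ)
  Solvable D = ∀ {N} ρ (S : Forms N) → Shape D ρ S → variableBound D ρ < N → HasRoot S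

  TopFormsSolvable : ℕ → ℕ → Set (c ⊔ ℓ)
  TopFormsSolvable D x = ∀ {N} (T : List (Hom N (suc D))) → length T ≡ x → ∀ g (L : Forms N) → Shape D g L →
                         variableBound D (g + M * (x * x)) + x * diagonalBound (suc D) < N → HasRootWith T L

  diagonalStep-bound : ∀ D → suc D ≤ d → ∀ x g g′ fuel k N → suc fuel + k ≡ suc (diagonalBound (suc D)) →
    g′ ≤ g + k * suc x →
    variableBound D (g + M * (suc x * suc x)) + suc x * diagonalBound (suc D) < N + k →
    variableBound D (g′ + M * (x * x)) + x * diagonalBound (suc D) < N
  diagonalStep-bound D D<d x g g′ fuel k N fuel+k g′≤ =
    variableBound-diagonalStep D x g g′ k N k≤ (diagonalBound≤M (1≤M ψ≤M (≤-trans (s≤s z≤n) D<d)) (suc D)) g′≤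
    where
      k≤ : k ≤ diagonalBound (suc D)
      k≤ = subst (k ≤_) (suc-injective fuel+k) (m≤n+m k fuel)

  -- Each eliminated variable adds a coefficient to the diagonal form a; fuel counts
  -- the steps left until it has suc (diagonalBound (suc D)) terms and is isotropic.
  diagonalise : ∀ D → suc D ≤ d → ∀ x g → TopFormsSolvable D x →
    ∀ fuel k → fuel + k ≡ suc (diagonalBound (suc D)) →
    ∀ {N} (F : Hom N (suc D)) T → length T ≡ x → ∀ g′ (L : Forms N) → Shape D g′ L → g′ ≤ g + k * suc x →
    (a : Vector Carrier k) →
    variableBound D (g + M * (suc x * suc x)) + suc x * diagonalBound (suc D) < N + k →
    DiagonalGoal F T L a
  diagonalise D D<d x g solvable zero k refl F T _ g′ L (degs , _) _ a _ ¬goal =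
    isotropic ψ≤M (suc D) (s≤s z≤n) D<d a λ (t , t-nonTrivial , root) →
      ¬goal ((λ _ → 0#) , t , inj₂ t-nonTrivial , origin-roots-top T , origin-roots D L degs ,
             FK.trans (FK.+-cong (⟦⟧-origin F) root) (FK.+-identityʳ 0#))
  diagonalise D D<d x g solvable (suc fuel) k fuel+k {zero} F T ∣T∣≡x g′ L shape g′≤ a bound _ =
    solvable T ∣T∣≡x g′ L shape (diagonalStep-bound D D<d x g g′ fuel k 0 fuel+k g′≤ bound) λ where
      (_ , (() , _) , _)
  diagonalise D D<d x g solvable (suc fuel) k fuel+k {suc n} F T ∣T∣≡x g′ L shape g′≤ a bound ¬goal =
    solvable T ∣T∣≡x g′ L shape (diagonalStep-bound D D<d x g g′ fuel k (suc n) fuel+k g′≤ bound) λ where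
      (y , (c , y[c]≉0) , T[y] , L[y]) →
        diagonalGoal-restrict y c y[c]≉0 F T L a T[y] L[y] (recurse y c) ¬goal
    where
      m+n*o+o≡m+[1+n]*o : ∀ g k s → g + k * s + s ≡ g + suc k * s
      m+n*o+o≡m+[1+n]*o g k s = trans (+-assoc g (k * s) s) (cong (g +_) (+-comm (k * s) s))
      recurse : ∀ y c → DiagonalGoal (x₀-free (Line.restrict y c F)) (Restriction.restrictTop y c D T)
                                     (Restriction.nextRest y c D L T F) (leadCoeff (Line.restrict y c F) ◂ a)
      recurse y c = diagonalise D D<d x g solvable fuel (suc k) (trans (+-suc fuel k) fuel+k)
        (x₀-free (restrict F)) (restrictTop T) (trans (length-map _ T) ∣T∣≡x)
        (g′ + suc x) (nextRest L T F) (subst (λ l → Shape D (g′ + suc l) (nextRest L T F)) ∣T∣≡x (nextRest-shape g′ L T F shape))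
        (≤-trans (+-monoˡ-≤ (suc x) g′≤) (≤-reflexive (m+n*o+o≡m+[1+n]*o g k (suc x))))
        (leadCoeff (restrict F) ◂ a) (≤-trans bound (≤-reflexive (sym (+-suc n k))))
        where
          open Line y c
          open Restriction y c D

  topFormsSolvable : ∀ D → suc D ≤ d → Solvable D → ∀ x → TopFormsSolvable D x
  topFormsSolvable D D<d solvable zero [] refl g L shape bound ¬goal =
    solvable g L shape (subst (_< _) bound≡ bound) λ (x , nonTrivial , L[x]) → ¬goal (x , nonTrivial , [] , L[x])
    where
      bound≡ : variableBound D (g + M * 0) + 0 ≡ variableBound D g
      bound≡ = trans (+-identityʳ _) (cong (variableBound D) (trans (cong (g +_) (*-zeroʳ M)) (+-identityʳ g)))
  topFormsSolvable D D<d solvable (suc x) (F ∷ T) ∣F∷T∣≡1+x g L shape bound ¬goal =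
    diagonalise D D<d x g (topFormsSolvable D D<d solvable x) (suc (diagonalBound (suc D))) 0 (+-identityʳ _)
      F T (suc-injective ∣F∷T∣≡1+x) g L shape (≤-reflexive (sym (+-identityʳ g))) (λ ())
      (subst (_ <_) (sym (+-identityʳ _)) bound)
      λ where
        (x , t , nonTrivial , T[x] , L[x] , root) →
          ¬goal (x , noDiagonalVariables nonTrivial , FK.trans (FK.sym (FK.+-identityʳ _)) root ∷ T[x] , L[x])
    where
      noDiagonalVariables : ∀ {x} {t : Vector Carrier 0} → NonTrivial K x ⊎ NonTrivial K t → NonTrivial K x
      noDiagonalVariables (inj₁ nonTrivial) = nonTrivial
      noDiagonalVariables (inj₂ (() , _))

  solvable : ∀ D → D ≤ d → Solvable D
  solvable zero _ {zero}  ρ S       shape                       ()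
  solvable zero _ {suc n} ρ []      shape                       _ ¬goal =
    ¬goal (unitVector fzero , unitVector-nonTrivial fzero , [])
  solvable zero _ {suc n} ρ (_ ∷ _) (((s≤s _ , ()) ∷ _) , _) _
  solvable (suc D) D<d ρ S (degs , counts) bound ¬goal =
    topFormsSolvable D D<d (solvable D (<⇒≤ D<d)) (length top) top refl (ρ * ρ) rest rest-shape bound′
      λ (x , nonTrivial , top[x] , rest[x]) → ¬goal (x , nonTrivial , roots x top[x] rest[x])
    where
      open TopSplit (topSplit D S degs)
      rest-shape : Shape D (ρ * ρ) rest
      rest-shape = rest-degrees , λ m m<D →
        ≤-trans (#deg-rest (D ∸ m)) (≤-trans (counts (suc m) (s≤s m<D)) (≤-reflexive (m^2^[1+n]≡[m*m]^2^n ρ m)))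
      ∣top∣≤ρ : length top ≤ ρ
      ∣top∣≤ρ = ≤-trans length-top (≤-trans (counts 0 (s≤s z≤n)) (≤-reflexive (*-identityʳ ρ)))
      bound′ : variableBound D (ρ * ρ + M * (length top * length top)) + length top * diagonalBound (suc D) < _
      bound′ = ≤-trans (s≤s (+-mono-≤ (variableBound-mono D (+-monoʳ-≤ (ρ * ρ) (*-monoʳ-≤ M (*-mono-≤ ∣top∣≤ρ ∣top∣≤ρ))))
                                      (*-monoˡ-≤ (diagonalBound (suc D)) ∣top∣≤ρ)))
                       bound

module FromCoefficients {c ℓ : Level} (K : Field c ℓ) where
  open import Data.Nat using (ℕ; zero; suc; _∸_)
  open import Data.Vec using (Vec; []; _∷_)
  open import Data.Vec.Functional using (head; tail)
  open import Data.List using ([]; _∷_; _++_; map; concat; applyUpTo)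
  open import Data.List.Properties using (map-++; map-∘)
  import Relation.Binary.PropositionalEquality as ≡
  open import Function using (id; _∘_)
  open Field K hiding (zero)
  open import Relation.Binary.Reasoning.Setoid setoid
  open import Algebra.Solver.Ring.NaturalCoefficients.Default commutativeSemiring using (solve; _:*_; _:=_)
  open Horner K

  raise₀ : ∀ {n} → Vec ℕ (suc n) → Vec ℕ (suc n)
  raise₀ (k ∷ e) = suc k ∷ e

  toHom : ∀ n i → Form K n i → Hom n i
  toHom zero    zero    f = κ (f [])
  toHom zero    (suc i) f = 0ᴴ
  toHom (suc n) zero    f = ↑ toHom n zero (λ e → f (0 ∷ e))
  toHom (suc n) (suc i) f = toHom n (suc i) (λ e → f (0 ∷ e)) +x₀· toHom (suc n) i (λ e → f (raise₀ e))

  monomials-raise₀ : ∀ n i (φ : ℕ → ℕ) m →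
    concat (map (λ k → map (k ∷_) (monomials n (suc i ∸ k))) (applyUpTo (suc ∘ φ) m)) ≡.≡
    map raise₀ (concat (map (λ k → map (k ∷_) (monomials n (i ∸ k))) (applyUpTo φ m)))
  monomials-raise₀ n i φ zero    = ≡.refl
  monomials-raise₀ n i φ (suc m) = ≡.trans
    (≡.cong₂ _++_ (map-∘ (monomials n (i ∸ φ 0))) (monomials-raise₀ n i (φ ∘ suc) m))
    (≡.sym (map-++ raise₀ (map (φ 0 ∷_) (monomials n (i ∸ φ 0))) _))

  monomials-suc : ∀ n i → monomials (suc n) (suc i) ≡.≡ map (0 ∷_) (monomials n (suc i)) ++ map raise₀ (monomials (suc n) i)
  monomials-suc n i = ≡.cong (map (0 ∷_) (monomials n (suc i)) ++_) (monomials-raise₀ n i id (suc i))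

  sumL-++ : ∀ {A : Set} (g : A → Carrier) xs ys → sumL K (map g (xs ++ ys)) ≈ sumL K (map g xs) + sumL K (map g ys)
  sumL-++ g []       ys = sym (+-identityˡ _)
  sumL-++ g (x ∷ xs) ys = trans (+-cong refl (sumL-++ g xs ys)) (sym (+-assoc _ _ _))

  sumL-cong : ∀ {A : Set} {g g′ : A → Carrier} xs → (∀ e → g e ≈ g′ e) → sumL K (map g xs) ≈ sumL K (map g′ xs)
  sumL-cong []       g≈g′ = refl
  sumL-cong (x ∷ xs) g≈g′ = +-cong (g≈g′ x) (sumL-cong xs g≈g′)

  sumL-*ˡ : ∀ {A : Set} a (g : A → Carrier) xs → sumL K (map (λ e → a * g e) xs) ≈ a * sumL K (map g xs)
  sumL-*ˡ a g []       = sym (zeroʳ _)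
  sumL-*ˡ a g (x ∷ xs) = trans (+-cong refl (sumL-*ˡ a g xs)) (sym (distribˡ _ _ _))

  sumL-map : ∀ {A B : Set} (g : B → Carrier) (f : A → B) xs → sumL K (map g (map f xs)) ≈ sumL K (map (g ∘ f) xs)
  sumL-map g f xs = reflexive (≡.cong (sumL K) (≡.sym (map-∘ xs)))

  ⟦toHom⟧ : ∀ n i f x → ⟦ toHom n i f ⟧ x ≈ eval K {n} {i} f x
  ⟦toHom⟧ zero    zero    f x = sym (trans (+-identityʳ _) (*-identityʳ _))
  ⟦toHom⟧ zero    (suc i) f x = refl
  ⟦toHom⟧ (suc n) zero    f x = begin
    ⟦ toHom n zero (λ e → f (0 ∷ e)) ⟧ (tail x)                         ≈⟨ ⟦toHom⟧ n zero _ (tail x) ⟩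
    sumL K (map (λ e → f (0 ∷ e) * monoVal K e (tail x)) (monomials n 0)) ≈⟨ sumL-cong (monomials n 0) (λ e → *-cong refl (sym (*-identityˡ _))) ⟩
    sumL K (map (λ e → g (0 ∷ e)) (monomials n 0))                       ≈⟨ sym (sumL-map g (0 ∷_) (monomials n 0)) ⟩
    sumL K (map g (map (0 ∷_) (monomials n 0)))                          ≈⟨ sym (+-identityʳ _) ⟩
    sumL K (map g (map (0 ∷_) (monomials n 0))) + 0#                     ≈⟨ sym (sumL-++ g (map (0 ∷_) (monomials n 0)) []) ⟩
    sumL K (map g (monomials (suc n) 0))                                 ∎
    where g = λ e → f e * monoVal K e x
  ⟦toHom⟧ (suc n) (suc i) f x = begin
    ⟦ toHom n (suc i) (λ e → f (0 ∷ e)) ⟧ (tail x) + head x * ⟦ toHom (suc n) i (λ e → f (raise₀ e)) ⟧ x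
      ≈⟨ +-cong (⟦toHom⟧ n (suc i) _ (tail x)) (*-cong refl (⟦toHom⟧ (suc n) i _ x)) ⟩
    sumL K (map (λ e → f (0 ∷ e) * monoVal K e (tail x)) (monomials n (suc i)))
      + head x * sumL K (map (λ e → f (raise₀ e) * monoVal K e x) (monomials (suc n) i))
      ≈⟨ +-cong (sumL-cong (monomials n (suc i)) (λ e → *-cong refl (sym (*-identityˡ _))))
                (trans (sym (sumL-*ˡ (head x) _ (monomials (suc n) i))) (sumL-cong (monomials (suc n) i) x₀*g≈g∘raise₀)) ⟩
    sumL K (map (g ∘ (0 ∷_)) (monomials n (suc i))) + sumL K (map (g ∘ raise₀) (monomials (suc n) i))
      ≈⟨ sym (+-cong (sumL-map g (0 ∷_) (monomials n (suc i))) (sumL-map g raise₀ (monomials (suc n) i))) ⟩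
    sumL K (map g (map (0 ∷_) (monomials n (suc i)))) + sumL K (map g (map raise₀ (monomials (suc n) i)))
      ≈⟨ sym (sumL-++ g (map (0 ∷_) (monomials n (suc i))) (map raise₀ (monomials (suc n) i))) ⟩
    sumL K (map g (map (0 ∷_) (monomials n (suc i)) ++ map raise₀ (monomials (suc n) i)))
      ≈⟨ reflexive (≡.cong (λ l → sumL K (map g l)) (≡.sym (monomials-suc n i))) ⟩
    sumL K (map g (monomials (suc n) (suc i))) ∎
    where
      g = λ e → f e * monoVal K e x
      x₀*g≈g∘raise₀ : ∀ e → head x * (f (raise₀ e) * monoVal K e x) ≈ g (raise₀ e)
      x₀*g≈g∘raise₀ (k ∷ e) =
        solve 4 (λ a b c d → a :* (b :* (c :* d)) := b :* ((a :* c) :* d)) refl (head x) _ _ _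

module SystemForms {c ℓ : Level} (K : Field c ℓ) {d : ℕ} {r : ℕ → ℕ} {n : ℕ} (h : System K d r n) where
  open import Data.Nat hiding (NonTrivial; _⊔_)
  open import Data.Nat.Properties
  open import Data.Fin using (Fin) renaming (suc to fsuc)
  open import Data.List using ([]; _++_; tabulate)
  open import Data.List.Relation.Unary.All using ([])
  open import Data.List.Relation.Unary.All.Properties using (++⁺; ++⁻; tabulate⁺; tabulate⁻)
  open import Data.Product using (_,_)
  open import Data.Sum using (inj₁; inj₂)
  open import Data.Empty using (⊥-elim)
  open import Relation.Nullary using (yes; no)
  open import Relation.Binary.PropositionalEquality using (_≡_; refl; sym; trans; cong; cong₂; subst)
  open Field K using (_≈_; 0#)
  module FK = Field K
  open Horner K
  open Counting K
  open FromCoefficients K using (toHom; ⟦toHom⟧)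
  open Arithmetic

  formsOfDegree : ∀ i → 1 ≤ i → i ≤ d → Forms n
  formsOfDegree i 1≤i i≤d = tabulate (λ l → i , toHom n i (h i 1≤i i≤d l))

  formsUpTo : ∀ m → m ≤ d → Forms n
  formsUpTo zero    _   = []
  formsUpTo (suc m) m<d = formsOfDegree (suc m) (s≤s z≤n) m<d ++ formsUpTo m (<⇒≤ m<d)

  formsUpTo-degrees : ∀ m m≤d → Degrees≤ d (formsUpTo m m≤d)
  formsUpTo-degrees zero    _   = []
  formsUpTo-degrees (suc m) m<d = ++⁺ (tabulate⁺ (λ _ → s≤s z≤n , m<d)) (formsUpTo-degrees m (<⇒≤ m<d))

  #deg-tabulate : ∀ i j {k} (f : Fin k → Hom n i) → #deg j (tabulate (λ l → i , f l)) ≡ 𝟙[ i ≡ j ] * k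
  #deg-tabulate i j {zero}  f = sym (*-zeroʳ 𝟙[ i ≡ j ])
  #deg-tabulate i j {suc k} f =
    trans (cong (𝟙[ i ≡ j ] +_) (#deg-tabulate i j (λ l → f (fsuc l)))) (sym (*-suc 𝟙[ i ≡ j ] k))

  #deg-formsOfDegree : ∀ i 1≤i i≤d j → #deg j (formsOfDegree i 1≤i i≤d) ≡ 𝟙[ i ≡ j ] * r i
  #deg-formsOfDegree i 1≤i i≤d j = #deg-tabulate i j _

  #deg-formsUpTo-beyond : ∀ m m≤d j → m < j → #deg j (formsUpTo m m≤d) ≡ 0
  #deg-formsUpTo-beyond zero    _   j _   = refl
  #deg-formsUpTo-beyond (suc m) m<d j m<j = trans (#deg-++ j (formsOfDegree (suc m) (s≤s z≤n) m<d) _)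
    (cong₂ _+_ (trans (#deg-formsOfDegree (suc m) _ m<d j) (cong (_* r (suc m)) (𝟙[i≡j]≡0 (<⇒≢ m<j))))
               (#deg-formsUpTo-beyond m _ j (<-trans (n<1+n m) m<j)))

  #deg-formsUpTo : ∀ m m≤d j → #deg j (formsUpTo m m≤d) ≤ r j
  #deg-formsUpTo zero    _   j = z≤n
  #deg-formsUpTo (suc m) m<d j = begin
    #deg j (formsOfDegree (suc m) (s≤s z≤n) m<d ++ formsUpTo m _)
      ≡⟨ #deg-++ j (formsOfDegree (suc m) (s≤s z≤n) m<d) _ ⟩
    #deg j (formsOfDegree (suc m) (s≤s z≤n) m<d) + #deg j (formsUpTo m _)
      ≡⟨ cong (_+ #deg j (formsUpTo m _)) (#deg-formsOfDegree (suc m) _ m<d j) ⟩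
    𝟙[ suc m ≡ j ] * r (suc m) + #deg j (formsUpTo m _)
      ≤⟨ top-or-below (suc m ≟ j) ⟩
    r j ∎
    where
      open ≤-Reasoning
      top-or-below : _ → 𝟙[ suc m ≡ j ] * r (suc m) + #deg j (formsUpTo m (<⇒≤ m<d)) ≤ r j
      top-or-below (yes refl) = ≤-reflexive (begin-equality
        𝟙[ suc m ≡ suc m ] * r (suc m) + #deg (suc m) (formsUpTo m _)
          ≡⟨ cong₂ (λ a b → a * r (suc m) + b) (𝟙[i≡i] (suc m)) (#deg-formsUpTo-beyond m _ (suc m) ≤-refl) ⟩
        1 * r (suc m) + 0  ≡⟨ trans (+-identityʳ _) (*-identityˡ _) ⟩
        r (suc m) ∎)
      top-or-below (no 1+m≢j) =
        subst (λ a → a * r (suc m) + #deg j (formsUpTo m _) ≤ r j) (sym (𝟙[i≡j]≡0 1+m≢j)) (#deg-formsUpTo m _ j)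

  formsUpTo-roots : ∀ m m≤d x → CommonRoot x (formsUpTo m m≤d) →
                    ∀ i (1≤i : 1 ≤ i) (i≤d : i ≤ d) → i ≤ m → ∀ l → eval K {n} {i} (h i 1≤i i≤d l) x ≈ 0#
  formsUpTo-roots zero    _   x _     (suc i) _ _ () l
  formsUpTo-roots (suc m) m<d x roots i 1≤i i≤d i≤1+m l with ++⁻ (formsOfDegree (suc m) (s≤s z≤n) m<d) roots | m≤n⇒m<n∨m≡n i≤1+m
  ... | _ , below | inj₁ i<1+m = formsUpTo-roots m _ x below i 1≤i i≤d (≤-pred i<1+m) l
  ... | top , _   | inj₂ refl  =
    FK.trans (FK.sym (⟦toHom⟧ n i (h i 1≤i i≤d l) x))
      (subst (λ G → ⟦ toHom n i G ⟧ x ≈ 0#) same-form (tabulate⁻ top l))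
    where
      same-form : h i (s≤s z≤n) m<d l ≡ h i 1≤i i≤d l
      same-form = cong₂ (λ p q → h i p q l) (≤-irrelevant _ _) (≤-irrelevant _ _)

  formsUpTo-shape : (∀ m → m < d → r (d ∸ m) ≤ r d ^ (2 ^ m)) → Shape d (r d) (formsUpTo d ≤-refl)
  formsUpTo-shape r-chain =
    formsUpTo-degrees d ≤-refl , λ m m<d → ≤-trans (#deg-formsUpTo d ≤-refl (d ∸ m)) (r-chain m m<d)

  variables≤variableBound : ∀ {M} → ψ≤ K d M → (∀ m → m < d → r (d ∸ m) ≤ r d ^ (2 ^ m)) →
                            NoCommonZero K {d} {r} h → n ≤ Bounds.variableBound M d (r d)
  variables≤variableBound {M} ψ≤M r-chain noZero with n ≤? Bounds.variableBound M d (r d)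
  ... | yes n≤bound = n≤bound
  ... | no  n≰bound = ⊥-elim (CommonRoots.solvable K ψ≤M d ≤-refl (r d) (formsUpTo d ≤-refl) (formsUpTo-shape r-chain)
                                (≰⇒> n≰bound)
                                λ (x , nonTrivial , roots) → noZero (x , nonTrivial , λ i 1≤i i≤d → formsUpTo-roots d ≤-refl x roots i 1≤i i≤d i≤d))

open import Data.Nat using (zero; suc; _≤_; _*_; _+_; _^_; _∸_; s≤s; z≤n)
open import Data.Fin.Properties using (injective⇒≤)
open import Data.Nat.Properties using (m≤m+n; module ≤-Reasoning)
open Arithmetic using (squaring-chain)
open Arithmetic.Bounds using (variableBound; variableBound+ρ^2^D≤)

lemma3p3 : ∀ {c ℓ : Level} (K : Field c ℓ) (d : ℕ) (r : ℕ → ℕ) →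
    2 ≤ d →
    (∀ i → 1 ≤ i → i ≤ d → 1 ≤ r i) →
    (∀ i → 2 ≤ i → i ≤ d → r (i ∸ 1) ≤ r i ^ 2) →
    (M : ℕ) → ψ≤ K d M →
    V≤ K d r (2 * r d ^ (2 ^ (d ∸ 1)) * (M + 1) ^ (2 ^ (d ∸ 1) ∸ 1))
lemma3p3 K (suc zero)        r (s≤s ()) _ _ M ψ≤M
lemma3p3 K d@(suc (suc D)) r _ _ r≤r² M ψ≤M n h noZero k ι ι-injective _ = begin
  k                                             ≤⟨ injective⇒≤ ι-injective ⟩
  n                                             ≤⟨ SystemForms.variables≤variableBound K h ψ≤M (squaring-chain d r r≤r²) noZero ⟩
  variableBound M d (r d)                       ≤⟨ m≤m+n _ _ ⟩
  variableBound M d (r d) + r d ^ (2 ^ suc D)   ≤⟨ variableBound+ρ^2^D≤ M (DiagonalForms.1≤M K ψ≤M (s≤s z≤n)) (suc D) (r d) ⟩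
  2 * r d ^ (2 ^ suc D) * (M + 1) ^ (2 ^ suc D ∸ 1) ∎
  where open ≤-Reasoning
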